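{- Let $(f_1,f_2)$ range over all bent vectorial functions from $\mathrm{GF}(2^4)$ to $\mathrm{GF}(2)^2$. Then every code $\mathcal{C}(f_1,f_2)$ is a binary $[16,7,6]$ code, and all such codes are equivalent to one another; i.e., up to equivalence there is exactly one $[16,7,6]$ code obtainable as $\mathcal{C}(f_1,f_2)$ from a $(4,2)$ bent vectorial function.
   Context: Write $\mathrm{GF}(2^{4})=\{u_1,\dots,u_{16}\}$ and let $\mathrm{tr}_{4/1}$ be the absolute trace to $\mathrm{GF}(2)$. A Boolean function $f:\mathrm{GF}(2^{4})\to\mathrm{GF}(2)$ is bent if $\left|\sum_{x}(-1)^{f(x)+\mathrm{tr}_{4/1}(wx)}\right|=4$ for all $w\in\mathrm{GF}(2^4)$. A pair $(f_1,f_2)$ of Boolean functions is a bent vectorial function if $f_1$, $f_2$ and $f_1+f_2$ are all bent. The truth table of $f$ is $(f(u_1),\dots,f(u_{16}))$. $\mathrm{RM}_2(1,4)=\{(\mathrm{tr}_{4/1}(bu_i)+c)_{i=1}^{16}: b\in\mathrm{GF}(2^4),c\in\mathrm{GF}(2)\}$, and $\mathcal{C}(f_1,f_2)$ is the binary linear code spanned by $\mathrm{RM}_2(1,4)$ and the truth tables of $f_1,f_2$. Two binary codes of the same length are equivalent if some permutation of coordinates maps one onto the other. -}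

module Defs where

open import Data.Bool using (Bool; true; false; _xor_; if_then_else_)
open import Data.Nat using (ℕ; zero; suc; _≤_)
open import Data.Fin using (Fin)
open import Data.List as List using (List; []; _∷_; _++_)
open import Data.Vec as Vec using (Vec; []; _∷_; lookup; tabulate; zipWith; replicate; fromList)
open import Data.Integer as ℤ using (ℤ; ∣_∣)
open import Data.Product using (Σ; ∃; ∃-syntax; _×_; _,_)
open import Data.Fin.Permutation using (Permutation′; _⟨$⟩ʳ_)
open import Relation.Binary.PropositionalEquality using (_≡_; _≢_)

-- GF(2^4) = GF(2)[α]/(α⁴ + α + 1); an element a₀ ∷ a₁ ∷ a₂ ∷ a₃ ∷ []
-- stands for a₀ + a₁α + a₂α² + a₃α³ (coefficients in GF(2) = Bool, + = xor).

GF16 : Set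
GF16 = Vec Bool 4

_+F_ : GF16 → GF16 → GF16
_+F_ = zipWith _xor_

zeroF : GF16
zeroF = replicate 4 false

-- multiplication by α (α⁴ = α + 1)
mulα : GF16 → GF16
mulα (a0 ∷ a1 ∷ a2 ∷ a3 ∷ []) = a3 ∷ (a0 xor a3) ∷ a1 ∷ a2 ∷ []

scaleF : Bool → GF16 → GF16
scaleF b x = if b then x else zeroF

_*F_ : GF16 → GF16 → GF16
x *F (y0 ∷ y1 ∷ y2 ∷ y3 ∷ []) =
  scaleF y0 x +F (scaleF y1 (mulα x) +F (scaleF y2 (mulα (mulα x)) +F scaleF y3 (mulα (mulα (mulα x)))))

sq : GF16 → GF16
sq x = x *F x

-- absolute trace tr_{4/1}(x) = x + x² + x⁴ + x⁸; its value lies in the prime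
-- field GF(2) ⊆ GF(2^4), and we read it off as the constant coefficient.
tr : GF16 → Bool
tr x with x +F (sq x +F (sq (sq x) +F sq (sq (sq x))))
... | t0 ∷ _ = t0

allBits : (n : ℕ) → List (Vec Bool n)
allBits zero = [] ∷ []
allBits (suc n) = List.map (false ∷_) (allBits n) ++ List.map (true ∷_) (allBits n)

elems : Vec GF16 16
elems = fromList (allBits 4)

BoolFun : Set
BoolFun = GF16 → Bool

sign : Bool → ℤ
sign b = if b then ℤ.-[1+ 0 ] else ℤ.+ 1

sumℤ : ∀ {n} → Vec ℤ n → ℤ
sumℤ = Vec.foldr _ ℤ._+_ (ℤ.+ 0)

walsh : BoolFun → GF16 → ℤ
walsh f w = sumℤ (Vec.map (λ x → sign (f x xor tr (w *F x))) elems)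

IsBent : BoolFun → Set
IsBent f = ∀ (w : GF16) → ∣ walsh f w ∣ ≡ 4

IsBentVectorial : BoolFun → BoolFun → Set
IsBentVectorial f1 f2 = IsBent f1 × IsBent f2 × IsBent (λ x → f1 x xor f2 x)

Word : ℕ → Set
Word n = Vec Bool n

_⊕_ : ∀ {n} → Word n → Word n → Word n
_⊕_ = zipWith _xor_

zeroW : ∀ {n} → Word n
zeroW = replicate _ false

Code : ℕ → Set₁
Code n = Word n → Set

lincomb : ∀ {n k} → Vec (Word n) k → Vec Bool k → Word n
lincomb [] [] = zeroW
lincomb (g ∷ gs) (a ∷ as) = (if a then g else zeroW) ⊕ lincomb gs as

Span : ∀ {n k} → Vec (Word n) k → Code n
Span gs c = ∃[ a ] lincomb gs a ≡ c

IsLinear : ∀ {n} → Code n → Set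
IsLinear C = C zeroW × (∀ c c′ → C c → C c′ → C (c ⊕ c′))

LinIndep : ∀ {n k} → Vec (Word n) k → Set
LinIndep gs = ∀ a → lincomb gs a ≡ zeroW → a ≡ replicate _ false

SameCode : ∀ {n} → Code n → Code n → Set
SameCode C D = ∀ c → (C c → D c) × (D c → C c)

HasDimension : ∀ {n} → Code n → ℕ → Set
HasDimension {n} C k = Σ (Vec (Word n) k) λ B → LinIndep B × SameCode C (Span B)

weight : ∀ {n} → Word n → ℕ
weight = Vec.count (λ b → Data.Bool._≟_ b true)
  where import Data.Bool

hamming : ∀ {n} → Word n → Word n → ℕ
hamming c c′ = weight (c ⊕ c′)

HasMinDistance : ∀ {n} → Code n → ℕ → Set
HasMinDistance C d =
  (∀ c c′ → C c → C c′ → c ≢ c′ → d ≤ hamming c c′) ×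
  (∃[ c ] ∃[ c′ ] (C c × C c′ × c ≢ c′ × hamming c c′ ≡ d))

Is[_,_,_]Code : (n k d : ℕ) → Code n → Set
Is[ n , k , d ]Code C = IsLinear C × HasDimension C k × HasMinDistance C d

permuteW : ∀ {n} → Permutation′ n → Word n → Word n
permuteW σ c = tabulate (λ i → lookup c (σ ⟨$⟩ʳ i))

Equivalent : ∀ {n} → Code n → Code n → Set
Equivalent {n} C D = Σ (Permutation′ n) λ σ → ∀ c → (C c → D (permuteW σ c)) × (D (permuteW σ c) → C c)

truthTable : BoolFun → Word 16
truthTable f = Vec.map f elems

rmGenerators : List (Word 16)
rmGenerators =
  List.concatMap (λ b → List.map (λ c → Vec.map (λ u → tr (b *F u) xor c) elems) (false ∷ true ∷ []))
                 (allBits 4)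

codeC : BoolFun → BoolFun → Code 16
codeC f1 f2 = Span (fromList (rmGenerators ++ truthTable f1 ∷ truthTable f2 ∷ []))

-- A bent function stays bent when an affine function is added, and a bent function on GF(2⁴)
-- has weight 6 or 10 (its Walsh value at 0 is ±4). A codeword of C(f₁, f₂) outside RM(1,4) is
-- f₁, f₂ or f₁ + f₂ plus an affine function, hence bent and of weight at least 6, while the
-- nonzero words of RM(1,4) have weight at least 8; so C(f₁, f₂) has dimension 7 and minimum
-- distance 6, attained by f₁ or its complement.
--
-- For the equivalence, replace each fᵢ by the representative of fᵢ + RM(1,4) vanishing at
-- 0, 1, α, α², α³. This changes neither the code nor bentness and is additive, and an exhaustive
-- search over the 2¹¹ such words shows that the bent ones lie in an explicit list of 28. For each
-- of the pairs from this list whose sum is also in it, a recorded coordinate permutation, with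
-- matrices proving that it maps bases into spans, carries the code onto a fixed reference code.

module Submission where

open import Defs
open import Algebra.Bundles using (CommutativeRing)
open import Data.Bool using (Bool; true; false; not; _xor_; _∧_; _∨_; T; if_then_else_)
open import Data.Bool.Properties using (xor-assoc; xor-identityˡ; xor-identityʳ; xor-same; xor-∧-commutativeRing)
  renaming (_≟_ to _≟ᵇ_)
open import Data.Empty using (⊥; ⊥-elim)
open import Data.Fin as Fin using (Fin; #_)
open import Data.Fin.Permutation using (Permutation′; _⟨$⟩ʳ_; _⟨$⟩ˡ_; permutation; inverseˡ; inverseʳ; flip; _∘ₚ_)
open import Data.Fin.Properties using (all?) renaming (_≟_ to _≟ᶠ_)
open import Data.Integer using (ℤ; +_; -[1+_]; ∣_∣; _+_; -_)
import Data.Integer.Properties as ℤ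
open import Data.Maybe using (Maybe; just; nothing)
import Data.Maybe.Relation.Unary.Any as Maybe
open import Data.Nat as ℕ using (ℕ; zero; suc; _≤_; _≡ᵇ_; _/_; _%_; NonZero)
import Data.Nat.Properties as ℕ
open import Data.Nat.DivMod using (_mod_)
open import Data.Product using (∃-syntax; _×_; _,_; proj₁; proj₂)
open import Data.Sum using (_⊎_; inj₁; inj₂; [_,_]′)
open import Data.Vec as Vec using (Vec; []; _∷_; _++_; lookup; replicate; tabulate; zipWith; fromList)
open import Data.Vec.Properties
  using (zipWith-assoc; zipWith-identityˡ; zipWith-identityʳ; map-∘; lookup-map; lookup-zipWith;
         lookup∘tabulate; tabulate∘lookup; tabulate-cong)
  renaming (≡-dec to ≡-decᵛ)
open import Data.Vec.Relation.Unary.All as All using (All; []; _∷_)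
open import Data.Vec.Relation.Unary.All.Properties using (lookup⁻; ++⁺)
open import Data.Vec.Relation.Unary.Any using (here; there; index)
open import Data.Vec.Relation.Unary.Any.Properties using (lookup-index)
open import Data.Vec.Membership.Propositional using (_∈_)
open import Data.Vec.Membership.Propositional.Properties using (∈-lookup)
open import Function using (_∘_)
open import Relation.Binary.Definitions using (DecidableEquality)
open import Relation.Binary.PropositionalEquality using (_≡_; _≢_; refl; sym; trans; cong; cong₂; subst; subst₂; module ≡-Reasoning)
open import Relation.Nullary.Decidable using (Dec; map′; from-yes; _×-dec_; _⊎-dec_; _→-dec_)
open import Relation.Unary using (Pred; Decidable)
open import Algebra.Properties.CommutativeSemigroup (CommutativeRing.+-commutativeSemigroup xor-∧-commutativeRing)
  using () renaming (interchange to xor-interchange)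
open import Algebra.Properties.CommutativeSemigroup ℤ.+-commutativeSemigroup
  using () renaming (interchange to +-interchange)

infix 4 _≟ʷ_
_≟ʷ_ : ∀ {n} → DecidableEquality (Word n)
_≟ʷ_ = ≡-decᵛ _≟ᵇ_

open import Data.Vec.Membership.DecPropositional (_≟ʷ_ {16}) using (_∈?_)

onesW : ∀ {n} → Word n
onesW = replicate _ true

module _ {n : ℕ} where

  ⊕-assoc : (x y z : Word n) → (x ⊕ y) ⊕ z ≡ x ⊕ (y ⊕ z)
  ⊕-assoc = zipWith-assoc xor-assoc

  ⊕-identityˡ : (x : Word n) → zeroW ⊕ x ≡ x
  ⊕-identityˡ = zipWith-identityˡ xor-identityˡ

  ⊕-identityʳ : (x : Word n) → x ⊕ zeroW ≡ x
  ⊕-identityʳ = zipWith-identityʳ xor-identityʳ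

⊕-self : ∀ {n} (x : Word n) → x ⊕ x ≡ zeroW
⊕-self []      = refl
⊕-self (a ∷ x) = cong₂ _∷_ (xor-same a) (⊕-self x)

⊕-interchange : ∀ {n} (a b c d : Word n) → (a ⊕ b) ⊕ (c ⊕ d) ≡ (a ⊕ c) ⊕ (b ⊕ d)
⊕-interchange []       []       []       []       = refl
⊕-interchange (a ∷ as) (b ∷ bs) (c ∷ cs) (d ∷ ds) =
  cong₂ _∷_ (xor-interchange a b c d) (⊕-interchange as bs cs ds)

⊕-cancelˡ : ∀ {n} (x y : Word n) → x ⊕ (x ⊕ y) ≡ y
⊕-cancelˡ x y = begin
  x ⊕ (x ⊕ y)  ≡⟨ ⊕-assoc x x y ⟨
  (x ⊕ x) ⊕ y  ≡⟨ cong (_⊕ y) (⊕-self x) ⟩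
  zeroW ⊕ y    ≡⟨ ⊕-identityˡ y ⟩
  y            ∎
  where open ≡-Reasoning

⊕≡zero⇒≡ : ∀ {n} {x y : Word n} → x ⊕ y ≡ zeroW → x ≡ y
⊕≡zero⇒≡ {x = x} {y} e = begin
  x            ≡⟨ ⊕-identityʳ x ⟨
  x ⊕ zeroW    ≡⟨ cong (x ⊕_) e ⟨
  x ⊕ (x ⊕ y)  ≡⟨ ⊕-cancelˡ x y ⟩
  y            ∎
  where open ≡-Reasoning

map-xor : ∀ {A : Set} {n} (f g : A → Bool) (xs : Vec A n) →
          Vec.map (λ x → f x xor g x) xs ≡ Vec.map f xs ⊕ Vec.map g xs
map-xor f g []       = refl
map-xor f g (x ∷ xs) = cong ((f x xor g x) ∷_) (map-xor f g xs)

zipWith-tabulate : ∀ {A B C : Set} {n} (h : A → B → C) (f : Fin n → A) (g : Fin n → B) →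
                   zipWith h (tabulate f) (tabulate g) ≡ tabulate (λ i → h (f i) (g i))
zipWith-tabulate {n = zero}  h f g = refl
zipWith-tabulate {n = suc n} h f g =
  cong (h (f Fin.zero) (g Fin.zero) ∷_) (zipWith-tabulate h (f ∘ Fin.suc) (g ∘ Fin.suc))

-- Linear combinations and spans

lincomb-++ : ∀ {n k l} (gs : Vec (Word n) k) (hs : Vec (Word n) l) a b →
             lincomb (gs ++ hs) (a ++ b) ≡ lincomb gs a ⊕ lincomb hs b
lincomb-++ []       hs []       b = sym (⊕-identityˡ (lincomb hs b))
lincomb-++ (g ∷ gs) hs (a ∷ as) b =
  trans (cong (_ ⊕_) (lincomb-++ gs hs as b)) (sym (⊕-assoc _ (lincomb gs as) (lincomb hs b)))

lincomb-zero : ∀ {n k} (gs : Vec (Word n) k) → lincomb gs zeroW ≡ zeroW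
lincomb-zero []       = refl
lincomb-zero (g ∷ gs) = trans (⊕-identityˡ _) (lincomb-zero gs)

lincomb-⊕ : ∀ {n k} (gs : Vec (Word n) k) a b → lincomb gs (a ⊕ b) ≡ lincomb gs a ⊕ lincomb gs b
lincomb-⊕ []       []       []       = sym (⊕-identityˡ zeroW)
lincomb-⊕ (g ∷ gs) (a ∷ as) (b ∷ bs) =
  trans (cong₂ _⊕_ (scale-xor a b) (lincomb-⊕ gs as bs))
        (⊕-interchange (scale a) (scale b) (lincomb gs as) (lincomb gs bs))
  where
  scale : Bool → Word _
  scale a = if a then g else zeroW
  scale-xor : ∀ a b → scale (a xor b) ≡ scale a ⊕ scale b
  scale-xor true  true  = sym (⊕-self g)
  scale-xor true  false = sym (⊕-identityʳ g)
  scale-xor false b     = sym (⊕-identityˡ (scale b))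

module _ {m n} {φ : Word m → Word n} (φ-⊕ : ∀ x y → φ (x ⊕ y) ≡ φ x ⊕ φ y) where

  additive⇒zero : φ zeroW ≡ zeroW
  additive⇒zero = begin
    φ zeroW              ≡⟨ cong φ (⊕-self zeroW) ⟨
    φ (zeroW ⊕ zeroW)    ≡⟨ φ-⊕ zeroW zeroW ⟩
    φ zeroW ⊕ φ zeroW    ≡⟨ ⊕-self (φ zeroW) ⟩
    zeroW                ∎
    where open ≡-Reasoning

  lincomb-map : ∀ {k} (gs : Vec (Word m) k) a → lincomb (Vec.map φ gs) a ≡ φ (lincomb gs a)
  lincomb-map []       []          = sym additive⇒zero
  lincomb-map (g ∷ gs) (true ∷ as)  = trans (cong (φ g ⊕_) (lincomb-map gs as)) (sym (φ-⊕ g _))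
  lincomb-map (g ∷ gs) (false ∷ as) =
    trans (⊕-identityˡ _) (trans (lincomb-map gs as) (cong φ (sym (⊕-identityˡ _))))

module _ {n k} (gs : Vec (Word n) k) where

  Span-zero : Span gs zeroW
  Span-zero = zeroW , lincomb-zero gs

  Span-⊕ : ∀ {x y} → Span gs x → Span gs y → Span gs (x ⊕ y)
  Span-⊕ (a , refl) (b , refl) = a ⊕ b , lincomb-⊕ gs a b

  Span-isLinear : IsLinear (Span gs)
  Span-isLinear = Span-zero , λ _ _ → Span-⊕

Span-∈ : ∀ {n k} {gs : Vec (Word n) k} {g} → g ∈ gs → Span gs g
Span-∈ {gs = g ∷ gs} (here refl) = true ∷ zeroW , trans (cong (g ⊕_) (lincomb-zero gs)) (⊕-identityʳ g)
Span-∈ (there g∈gs) with Span-∈ g∈gs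
... | a , e = false ∷ a , trans (⊕-identityˡ _) e

Span-generators : ∀ {n k} (gs : Vec (Word n) k) → All (Span gs) gs
Span-generators gs = lookup⁻ (λ i → Span-∈ (∈-lookup i gs))

module _ {n k l} (gs : Vec (Word n) k) (hs : Vec (Word n) l) where

  Span-++ˡ : ∀ {x} → Span gs x → Span (gs ++ hs) x
  Span-++ˡ (a , refl) =
    a ++ zeroW , trans (lincomb-++ gs hs a zeroW) (trans (cong (_ ⊕_) (lincomb-zero hs)) (⊕-identityʳ _))

  Span-++ʳ : ∀ {x} → Span hs x → Span (gs ++ hs) x
  Span-++ʳ (b , refl) =
    zeroW ++ b , trans (lincomb-++ gs hs zeroW b) (trans (cong (_⊕ _) (lincomb-zero gs)) (⊕-identityˡ _))

Span-⊆ : ∀ {n k m} (hs : Vec (Word n) k) {gs : Vec (Word n) m} → All (Span hs) gs → ∀ {c} → Span gs c → Span hs c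
Span-⊆ hs []       ([] , refl)         = Span-zero hs
Span-⊆ hs (p ∷ ps) (true ∷ as , refl)  = Span-⊕ hs p (Span-⊆ hs ps (as , refl))
Span-⊆ hs (p ∷ ps) (false ∷ as , refl) = Span-⊕ hs (Span-zero hs) (Span-⊆ hs ps (as , refl))

sameSpan : ∀ {n k m} (gs : Vec (Word n) k) (hs : Vec (Word n) m) →
           All (Span hs) gs → All (Span gs) hs → SameCode (Span gs) (Span hs)
sameSpan gs hs gs⊆hs hs⊆gs c = Span-⊆ hs gs⊆hs , Span-⊆ gs hs⊆gs

Span-++-cong : ∀ {n k m l} (gs : Vec (Word n) k) (hs : Vec (Word n) m) (ks : Vec (Word n) l) →
               All (Span hs) gs → All (Span gs) hs → SameCode (Span (gs ++ ks)) (Span (hs ++ ks))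
Span-++-cong gs hs ks gs⊆hs hs⊆gs =
  sameSpan (gs ++ ks) (hs ++ ks)
    (++⁺ (All.map (Span-++ˡ hs ks) gs⊆hs) (All.map (Span-++ʳ hs ks) (Span-generators ks)))
    (++⁺ (All.map (Span-++ˡ gs ks) hs⊆gs) (All.map (Span-++ʳ gs ks) (Span-generators ks)))

Span-shift : ∀ {n k} (gs : Vec (Word n) k) {a₁ a₂ : Word n} (t₁ t₂ : Word n) → Span gs a₁ → Span gs a₂ →
             SameCode (Span (gs ++ t₁ ∷ t₂ ∷ [])) (Span (gs ++ (a₁ ⊕ t₁) ∷ (a₂ ⊕ t₂) ∷ []))
Span-shift gs t₁ t₂ p₁ p₂ =
  sameSpan (gs ++ _ ∷ _ ∷ []) (gs ++ _ ∷ _ ∷ [])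
    (++⁺ (All.map (Span-++ˡ gs _) (Span-generators gs))
         (unshift p₁ (here refl) ∷ unshift p₂ (there (here refl)) ∷ []))
    (++⁺ (All.map (Span-++ˡ gs _) (Span-generators gs))
         (shift p₁ (here refl) ∷ shift p₂ (there (here refl)) ∷ []))
  where
  shift : ∀ {a t} {ts : Vec (Word _) 2} → Span gs a → t ∈ ts → Span (gs ++ ts) (a ⊕ t)
  shift {ts = ts} p t∈ts = Span-⊕ (gs ++ ts) (Span-++ˡ gs ts p) (Span-++ʳ gs ts (Span-∈ t∈ts))
  unshift : ∀ {a t} {ts : Vec (Word _) 2} → Span gs a → a ⊕ t ∈ ts → Span (gs ++ ts) t
  unshift {a} {t} {ts} p at∈ts = subst (Span (gs ++ ts)) (⊕-cancelˡ a t) (shift p at∈ts)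

-- Codes, coordinate permutations and equivalence

SameCode-trans : ∀ {n} {C D E : Code n} → SameCode C D → SameCode D E → SameCode C E
SameCode-trans C≈D D≈E c = proj₁ (D≈E c) ∘ proj₁ (C≈D c) , proj₂ (C≈D c) ∘ proj₂ (D≈E c)

code-resp : ∀ {n k d} {C D : Code n} → SameCode C D → Is[ n , k , d ]Code D → Is[ n , k , d ]Code C
code-resp {C = C} C≈D ((z , closed) , (B , indep , D≈B) , (md , (c , c′ , p , q , c≢c′ , dist))) =
  (from z , λ x y p q → from (closed x y (to p) (to q))) ,
  (B , indep , SameCode-trans C≈D D≈B) ,
  ((λ x y p q → md x y (to p) (to q)) , (c , c′ , from p , from q , c≢c′ , dist))
  where
  to : ∀ {c} → C c → _
  to {c} = proj₁ (C≈D c)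
  from : ∀ {c} → _ → C c
  from {c} = proj₂ (C≈D c)

weight-zeroW : ∀ {n} → weight (zeroW {n}) ≡ 0
weight-zeroW {zero}  = refl
weight-zeroW {suc n} = weight-zeroW {n}

weight≢zero : ∀ {n m} {c : Word n} → c ≡ zeroW → suc m ≤ weight c → ⊥
weight≢zero {n} refl p = ℕ.n≮0 (subst (suc _ ≤_) (weight-zeroW {n}) p)

minWeight⇒HasMinDistance : ∀ {n d} {C : Code n} → IsLinear C →
  (∀ c → C c → c ≢ zeroW → d ≤ weight c) → (∃[ c ] C c × weight c ≡ d) → d ≢ 0 → HasMinDistance C d
minWeight⇒HasMinDistance {n} {C = C} (C0 , closed) light (c , Cc , wc) d≢0 =
  (λ x y Cx Cy x≢y → light (x ⊕ y) (closed x y Cx Cy) (x≢y ∘ ⊕≡zero⇒≡)) ,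
  (c , zeroW , Cc , C0 , c≢0 , trans (cong weight (⊕-identityʳ c)) wc)
  where
  c≢0 : c ≢ zeroW
  c≢0 c≡0 = d≢0 (trans (sym wc) (trans (cong weight c≡0) (weight-zeroW {n})))

module _ {n} (σ : Permutation′ n) where

  permuteW-⊕ : ∀ (x y : Word n) → permuteW σ (x ⊕ y) ≡ permuteW σ x ⊕ permuteW σ y
  permuteW-⊕ x y = begin
    tabulate (λ i → lookup (x ⊕ y) (σ ⟨$⟩ʳ i))
      ≡⟨ tabulate-cong (λ i → lookup-zipWith _xor_ (σ ⟨$⟩ʳ i) x y) ⟩
    tabulate (λ i → lookup x (σ ⟨$⟩ʳ i) xor lookup y (σ ⟨$⟩ʳ i))
      ≡⟨ zipWith-tabulate _xor_ _ _ ⟨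
    permuteW σ x ⊕ permuteW σ y ∎
    where open ≡-Reasoning

  permuteW-flip : ∀ (c : Word n) → permuteW σ (permuteW (flip σ) c) ≡ c
  permuteW-flip c = begin
    tabulate (λ i → lookup (permuteW (flip σ) c) (σ ⟨$⟩ʳ i))
      ≡⟨ tabulate-cong (λ i → trans (lookup∘tabulate _ (σ ⟨$⟩ʳ i)) (cong (lookup c) (inverseˡ σ))) ⟩
    tabulate (lookup c)
      ≡⟨ tabulate∘lookup c ⟩
    c ∎
    where open ≡-Reasoning

  permuteW-injective : ∀ {x y : Word n} → permuteW σ x ≡ permuteW σ y → x ≡ y
  permuteW-injective {x} {y} e = begin
    x                                  ≡⟨ unflip x ⟨
    permuteW (flip σ) (permuteW σ x)   ≡⟨ cong (permuteW (flip σ)) e ⟩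
    permuteW (flip σ) (permuteW σ y)   ≡⟨ unflip y ⟩
    y                                  ∎
    where
    open ≡-Reasoning
    unflip : ∀ c → permuteW (flip σ) (permuteW σ c) ≡ c
    unflip c = trans (tabulate-cong (λ i → trans (lookup∘tabulate _ (σ ⟨$⟩ˡ i)) (cong (lookup c) (inverseʳ σ))))
                     (tabulate∘lookup c)

  Span-permuteW : ∀ {k} (gs : Vec (Word n) k) → Equivalent (Span gs) (Span (Vec.map (permuteW σ) gs))
  Span-permuteW gs = σ , λ c → to c , from c
    where
    to : ∀ c → Span gs c → Span (Vec.map (permuteW σ) gs) (permuteW σ c)
    to c (a , refl) = a , lincomb-map {φ = permuteW σ} permuteW-⊕ gs a
    from : ∀ c → Span (Vec.map (permuteW σ) gs) (permuteW σ c) → Span gs c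
    from c (a , e) = a , permuteW-injective (trans (sym (lincomb-map {φ = permuteW σ} permuteW-⊕ gs a)) e)

permuteW-∘ : ∀ {n} (τ σ : Permutation′ n) (c : Word n) → permuteW (τ ∘ₚ σ) c ≡ permuteW τ (permuteW σ c)
permuteW-∘ τ σ c = sym (tabulate-cong (λ i → lookup∘tabulate _ (τ ⟨$⟩ʳ i)))

Equivalent-sym : ∀ {n} {C D : Code n} → Equivalent C D → Equivalent D C
Equivalent-sym {D = D} (σ , C⇔D) = flip σ , λ c →
  (λ Dc → proj₂ (C⇔D (permuteW (flip σ) c)) (subst D (sym (permuteW-flip σ c)) Dc)) ,
  (λ Cc → subst D (permuteW-flip σ c) (proj₁ (C⇔D (permuteW (flip σ) c)) Cc))

Equivalent-trans : ∀ {n} {C D E : Code n} → Equivalent C D → Equivalent D E → Equivalent C E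
Equivalent-trans {E = E} (σ , C⇔D) (τ , D⇔E) = τ ∘ₚ σ , λ c →
  (λ Cc → subst E (sym (permuteW-∘ τ σ c)) (proj₁ (D⇔E (permuteW σ c)) (proj₁ (C⇔D c) Cc))) ,
  (λ Ec → proj₂ (C⇔D c) (proj₂ (D⇔E (permuteW σ c)) (subst E (permuteW-∘ τ σ c) Ec)))

Equivalent-respˡ : ∀ {n} {C C′ D : Code n} → SameCode C C′ → Equivalent C′ D → Equivalent C D
Equivalent-respˡ C≈C′ (σ , C′⇔D) = σ , λ c →
  proj₁ (C′⇔D c) ∘ proj₁ (C≈C′ c) , proj₂ (C≈C′ c) ∘ proj₂ (C′⇔D c)

Equivalent-respʳ : ∀ {n} {C D D′ : Code n} → Equivalent C D → SameCode D D′ → Equivalent C D′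
Equivalent-respʳ (σ , C⇔D) D≈D′ = σ , λ c →
  proj₁ (D≈D′ _) ∘ proj₁ (C⇔D c) , proj₂ (C⇔D c) ∘ proj₂ (D≈D′ _)

∀-word? : ∀ n {p} {P : Pred (Word n) p} → Decidable P → Dec (∀ v → P v)
∀-word? zero    P? = map′ (λ p → λ { [] → p }) (λ h → h []) (P? [])
∀-word? (suc n) P? =
  map′ (λ (p₀ , p₁) → λ { (false ∷ v) → p₀ v ; (true ∷ v) → p₁ v })
       (λ h → (λ v → h (false ∷ v)) , (λ v → h (true ∷ v)))
       (∀-word? n (λ v → P? (false ∷ v)) ×-dec ∀-word? n (λ v → P? (true ∷ v)))

-- Sign sums and weights

signSum : ∀ {n} → Word n → ℤ
signSum t = sumℤ (Vec.map sign t)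

signSum-weight : ∀ {n} (t : Word n) → signSum t + + (2 ℕ.* weight t) ≡ + n
signSum-weight []          = refl
signSum-weight (false ∷ t) = trans (ℤ.+-assoc (+ 1) (signSum t) _) (cong (_+_ (+ 1)) (signSum-weight t))
signSum-weight (true ∷ t)  = begin
  (-[1+ 0 ] + signSum t) + + (2 ℕ.* suc (weight t))
    ≡⟨ cong (λ m → (-[1+ 0 ] + signSum t) + + m) (ℕ.*-distribˡ-+ 2 1 (weight t)) ⟩
  (-[1+ 0 ] + signSum t) + (+ 2 + + (2 ℕ.* weight t))
    ≡⟨ +-interchange -[1+ 0 ] (signSum t) (+ 2) _ ⟩
  + 1 + (signSum t + + (2 ℕ.* weight t))
    ≡⟨ cong (_+_ (+ 1)) (signSum-weight t) ⟩
  + suc _ ∎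
  where open ≡-Reasoning

signSum-complement : ∀ {n} (t : Word n) → signSum (onesW ⊕ t) ≡ - signSum t
signSum-complement []      = refl
signSum-complement (a ∷ t) =
  trans (cong₂ _+_ (sign-not a) (signSum-complement t)) (sym (ℤ.neg-distrib-+ (sign a) (signSum t)))
  where
  sign-not : ∀ a → sign (not a) ≡ - sign a
  sign-not true  = refl
  sign-not false = refl

∣signSum∣-complement : ∀ {n} c (t : Word n) → ∣ signSum ((if c then onesW else zeroW) ⊕ t) ∣ ≡ ∣ signSum t ∣
∣signSum∣-complement true  t = trans (cong ∣_∣ (signSum-complement t)) (ℤ.∣-i∣≡∣i∣ (signSum t))
∣signSum∣-complement false t = cong (∣_∣ ∘ signSum) (⊕-identityˡ t)

module _ (t : Word 16) where

  private
    w₂ : ℤ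
    w₂ = + (2 ℕ.* weight t)

  signSum+4⇒weight : signSum t ≡ + 4 → weight t ≡ 6
  signSum+4⇒weight s≡4 = ℕ.*-cancelˡ-≡ _ _ 2 (ℕ.+-cancelˡ-≡ 4 _ _ (ℤ.+-injective (begin
    + 4 + w₂        ≡⟨ cong (_+ w₂) s≡4 ⟨
    signSum t + w₂  ≡⟨ signSum-weight t ⟩
    + 16            ∎)))
    where open ≡-Reasoning

  signSum-4⇒weight : signSum t ≡ -[1+ 3 ] → weight t ≡ 10
  signSum-4⇒weight s≡-4 = ℕ.*-cancelˡ-≡ _ _ 2 (ℤ.+-injective (begin
    w₂                           ≡⟨ ℤ.+-identityˡ w₂ ⟨
    (+ 4 + -[1+ 3 ]) + w₂        ≡⟨ ℤ.+-assoc (+ 4) -[1+ 3 ] w₂ ⟩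
    + 4 + (-[1+ 3 ] + w₂)        ≡⟨ cong (λ s → + 4 + (s + w₂)) s≡-4 ⟨
    + 4 + (signSum t + w₂)       ≡⟨ cong (_+_ (+ 4)) (signSum-weight t) ⟩
    + 20                         ∎))
    where open ≡-Reasoning

-- Walsh transform and bentness of truth tables

-- The truth table of u ↦ tr(b u), tabulated: the exhaustive checks below evaluate it thousands of times.
trWord : GF16 → Word 16
trWord (false ∷ false ∷ false ∷ false ∷ []) = false ∷ false ∷ false ∷ false ∷ false ∷ false ∷ false ∷ false ∷ false ∷ false ∷ false ∷ false ∷ false ∷ false ∷ false ∷ false ∷ []
trWord (false ∷ false ∷ false ∷ true ∷ []) = false ∷ true ∷ false ∷ true ∷ false ∷ true ∷ false ∷ true ∷ true ∷ false ∷ true ∷ false ∷ true ∷ false ∷ true ∷ false ∷ []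
trWord (false ∷ false ∷ true ∷ false ∷ []) = false ∷ false ∷ false ∷ false ∷ true ∷ true ∷ true ∷ true ∷ false ∷ false ∷ false ∷ false ∷ true ∷ true ∷ true ∷ true ∷ []
trWord (false ∷ false ∷ true ∷ true ∷ []) = false ∷ true ∷ false ∷ true ∷ true ∷ false ∷ true ∷ false ∷ true ∷ false ∷ true ∷ false ∷ false ∷ true ∷ false ∷ true ∷ []
trWord (false ∷ true ∷ false ∷ false ∷ []) = false ∷ false ∷ true ∷ true ∷ false ∷ false ∷ true ∷ true ∷ false ∷ false ∷ true ∷ true ∷ false ∷ false ∷ true ∷ true ∷ []
trWord (false ∷ true ∷ false ∷ true ∷ []) = false ∷ true ∷ true ∷ false ∷ false ∷ true ∷ true ∷ false ∷ true ∷ false ∷ false ∷ true ∷ true ∷ false ∷ false ∷ true ∷ []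
trWord (false ∷ true ∷ true ∷ false ∷ []) = false ∷ false ∷ true ∷ true ∷ true ∷ true ∷ false ∷ false ∷ false ∷ false ∷ true ∷ true ∷ true ∷ true ∷ false ∷ false ∷ []
trWord (false ∷ true ∷ true ∷ true ∷ []) = false ∷ true ∷ true ∷ false ∷ true ∷ false ∷ false ∷ true ∷ true ∷ false ∷ false ∷ true ∷ false ∷ true ∷ true ∷ false ∷ []
trWord (true ∷ false ∷ false ∷ false ∷ []) = false ∷ true ∷ false ∷ true ∷ false ∷ true ∷ false ∷ true ∷ false ∷ true ∷ false ∷ true ∷ false ∷ true ∷ false ∷ true ∷ []
trWord (true ∷ false ∷ false ∷ true ∷ []) = false ∷ false ∷ false ∷ false ∷ false ∷ false ∷ false ∷ false ∷ true ∷ true ∷ true ∷ true ∷ true ∷ true ∷ true ∷ true ∷ []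
trWord (true ∷ false ∷ true ∷ false ∷ []) = false ∷ true ∷ false ∷ true ∷ true ∷ false ∷ true ∷ false ∷ false ∷ true ∷ false ∷ true ∷ true ∷ false ∷ true ∷ false ∷ []
trWord (true ∷ false ∷ true ∷ true ∷ []) = false ∷ false ∷ false ∷ false ∷ true ∷ true ∷ true ∷ true ∷ true ∷ true ∷ true ∷ true ∷ false ∷ false ∷ false ∷ false ∷ []
trWord (true ∷ true ∷ false ∷ false ∷ []) = false ∷ true ∷ true ∷ false ∷ false ∷ true ∷ true ∷ false ∷ false ∷ true ∷ true ∷ false ∷ false ∷ true ∷ true ∷ false ∷ []
trWord (true ∷ true ∷ false ∷ true ∷ []) = false ∷ false ∷ true ∷ true ∷ false ∷ false ∷ true ∷ true ∷ true ∷ true ∷ false ∷ false ∷ true ∷ true ∷ false ∷ false ∷ []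
trWord (true ∷ true ∷ true ∷ false ∷ []) = false ∷ true ∷ true ∷ false ∷ true ∷ false ∷ false ∷ true ∷ false ∷ true ∷ true ∷ false ∷ true ∷ false ∷ false ∷ true ∷ []
trWord (true ∷ true ∷ true ∷ true ∷ []) = false ∷ false ∷ true ∷ true ∷ true ∷ true ∷ false ∷ false ∷ true ∷ true ∷ false ∷ false ∷ false ∷ false ∷ true ∷ true ∷ []

trWord-correct : ∀ b → trWord b ≡ truthTable (λ u → tr (b *F u))
trWord-correct = from-yes (∀-word? 4 λ b → trWord b ≟ʷ truthTable (λ u → tr (b *F u)))

IsBentW : Word 16 → Set
IsBentW t = ∀ w → ∣ signSum (t ⊕ trWord w) ∣ ≡ 4

bentW? : Decidable IsBentW
bentW? t = ∀-word? 4 (λ w → ∣ signSum (t ⊕ trWord w) ∣ ℕ.≟ 4)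

walsh-signSum : ∀ f w → walsh f w ≡ signSum (truthTable f ⊕ trWord w)
walsh-signSum f w = cong sumℤ (begin
  Vec.map (sign ∘ (λ u → f u xor tr (w *F u))) elems                ≡⟨ map-∘ sign (λ u → f u xor tr (w *F u)) elems ⟩
  Vec.map sign (Vec.map (λ u → f u xor tr (w *F u)) elems)          ≡⟨ cong (Vec.map sign) (map-xor f (λ u → tr (w *F u)) elems) ⟩
  Vec.map sign (truthTable f ⊕ truthTable (λ u → tr (w *F u)))     ≡⟨ cong (λ r → Vec.map sign (truthTable f ⊕ r)) (trWord-correct w) ⟨
  Vec.map sign (truthTable f ⊕ trWord w)                           ∎)
  where open ≡-Reasoning

IsBent⇒IsBentW : ∀ f → IsBent f → IsBentW (truthTable f)
IsBent⇒IsBentW f bent w = trans (cong ∣_∣ (sym (walsh-signSum f w))) (bent w)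

IsBentW-signSum : ∀ t → IsBentW t → signSum t ≡ + 4 ⊎ signSum t ≡ -[1+ 3 ]
IsBentW-signSum t bent = ∣∣≡4 (signSum t) (trans (cong (∣_∣ ∘ signSum) (sym (⊕-identityʳ t))) (bent zeroF))
  where
  ∣∣≡4 : ∀ s → ∣ s ∣ ≡ 4 → s ≡ + 4 ⊎ s ≡ -[1+ 3 ]
  ∣∣≡4 (+ _)      refl = inj₁ refl
  ∣∣≡4 -[1+ _ ]   refl = inj₂ refl

IsBentW-weight : ∀ t → IsBentW t → weight t ≡ 6 ⊎ weight t ≡ 10
IsBentW-weight t bent with IsBentW-signSum t bent
... | inj₁ s≡4  = inj₁ (signSum+4⇒weight t s≡4)
... | inj₂ s≡-4 = inj₂ (signSum-4⇒weight t s≡-4)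

IsBentW-6≤weight : ∀ t → IsBentW t → 6 ≤ weight t
IsBentW-6≤weight t bent with IsBentW-weight t bent
... | inj₁ w≡6  = ℕ.≤-reflexive (sym w≡6)
... | inj₂ w≡10 = ℕ.≤-trans (ℕ.m≤n+m 6 4) (ℕ.≤-reflexive (sym w≡10))

IsBentW-weight-6 : ∀ t → IsBentW t → weight t ≡ 6 ⊎ weight (onesW ⊕ t) ≡ 6
IsBentW-weight-6 t bent with IsBentW-signSum t bent
... | inj₁ s≡4  = inj₁ (signSum+4⇒weight t s≡4)
... | inj₂ s≡-4 = inj₂ (signSum+4⇒weight (onesW ⊕ t) (trans (signSum-complement t) (cong -_ s≡-4)))

trWord-⊕ : ∀ b w → trWord (b ⊕ w) ≡ trWord b ⊕ trWord w
trWord-⊕ = from-yes (∀-word? 4 λ b → ∀-word? 4 λ w → trWord (b ⊕ w) ≟ʷ trWord b ⊕ trWord w)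

affineW : Bool → GF16 → Word 16
affineW c b = (if c then onesW else zeroW) ⊕ trWord b

IsBentW-affine : ∀ c b t → IsBentW t → IsBentW (affineW c b ⊕ t)
IsBentW-affine c b t bent w = begin
  ∣ signSum ((affineW c b ⊕ t) ⊕ trWord w) ∣       ≡⟨ cong (∣_∣ ∘ signSum) rearrange ⟩
  ∣ signSum (i ⊕ (t ⊕ trWord (b ⊕ w))) ∣           ≡⟨ ∣signSum∣-complement c _ ⟩
  ∣ signSum (t ⊕ trWord (b ⊕ w)) ∣                 ≡⟨ bent (b ⊕ w) ⟩
  4                                                ∎
  where
  open ≡-Reasoning
  i = if c then onesW else zeroW
  rearrange : (affineW c b ⊕ t) ⊕ trWord w ≡ i ⊕ (t ⊕ trWord (b ⊕ w))
  rearrange = begin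
    ((i ⊕ trWord b) ⊕ t) ⊕ trWord w      ≡⟨ ⊕-assoc (i ⊕ trWord b) t (trWord w) ⟩
    (i ⊕ trWord b) ⊕ (t ⊕ trWord w)      ≡⟨ ⊕-interchange i (trWord b) t (trWord w) ⟩
    (i ⊕ t) ⊕ (trWord b ⊕ trWord w)      ≡⟨ ⊕-assoc i t _ ⟩
    i ⊕ (t ⊕ (trWord b ⊕ trWord w))      ≡⟨ cong (λ x → i ⊕ (t ⊕ x)) (trWord-⊕ b w) ⟨
    i ⊕ (t ⊕ trWord (b ⊕ w))             ∎

-- The first-order Reed–Muller code and normalisation of a coset

-- The trace-dual basis (1 + α³, α², α, 1) of (1, α, α², α³).
dualBasis : Vec GF16 4
dualBasis = (true ∷ false ∷ false ∷ true ∷ []) ∷ (false ∷ false ∷ true ∷ false ∷ []) ∷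
            (false ∷ true ∷ false ∷ false ∷ []) ∷ (true ∷ false ∷ false ∷ false ∷ []) ∷ []

rmBasis : Vec (Word 16) 5
rmBasis = onesW ∷ Vec.map trWord dualBasis

RM : Code 16
RM = Span rmBasis

RM-affine : ∀ c r → lincomb rmBasis (c ∷ r) ≡ affineW c (lincomb dualBasis r)
RM-affine c r = cong ((if c then onesW else zeroW) ⊕_) (lincomb-map {φ = trWord} trWord-⊕ dualBasis r)

IsBentW-RM : ∀ {a} t → RM a → IsBentW t → IsBentW (a ⊕ t)
IsBentW-RM t (c ∷ r , refl) bent =
  subst (λ a → IsBentW (a ⊕ t)) (sym (RM-affine c r)) (IsBentW-affine c (lincomb dualBasis r) t bent)

RM-weight : ∀ r → r ≡ zeroW ⊎ 8 ≤ weight (lincomb rmBasis r)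
RM-weight = from-yes (∀-word? 5 λ r → (r ≟ʷ zeroW) ⊎-dec (8 ℕ.≤? weight (lincomb rmBasis r)))

RM-weight⁺ : ∀ r → lincomb rmBasis r ≢ zeroW → 8 ≤ weight (lincomb rmBasis r)
RM-weight⁺ r nz =
  [ (λ r≡0 → ⊥-elim (nz (trans (cong (lincomb rmBasis) r≡0) (lincomb-zero rmBasis)))) , (λ 8≤w → 8≤w) ]′ (RM-weight r)

RM-independent : LinIndep rmBasis
RM-independent r e = [ (λ r≡0 → r≡0) , (λ 8≤w → ⊥-elim (weight≢zero e 8≤w)) ]′ (RM-weight r)

-- Positions 0, 8, 4, 2, 1 of elems hold 0, 1, α, α², α³.
coords : Word 16 → Vec Bool 5
coords (t₀ ∷ t₁ ∷ t₂ ∷ _ ∷ t₄ ∷ _ ∷ _ ∷ _ ∷ t₈ ∷ _) = t₀ ∷ (t₀ xor t₈) ∷ (t₀ xor t₄) ∷ (t₀ xor t₂) ∷ (t₀ xor t₁) ∷ []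

coords-⊕ : ∀ t s → coords (t ⊕ s) ≡ coords t ⊕ coords s
coords-⊕ (t₀ ∷ t₁ ∷ t₂ ∷ _ ∷ t₄ ∷ _ ∷ _ ∷ _ ∷ t₈ ∷ _) (s₀ ∷ s₁ ∷ s₂ ∷ _ ∷ s₄ ∷ _ ∷ _ ∷ _ ∷ s₈ ∷ _) =
  cong ((t₀ xor s₀) ∷_) (cong₂ _∷_ (xor-interchange t₀ s₀ t₈ s₈) (cong₂ _∷_ (xor-interchange t₀ s₀ t₄ s₄)
    (cong₂ _∷_ (xor-interchange t₀ s₀ t₂ s₂) (cong₂ _∷_ (xor-interchange t₀ s₀ t₁ s₁) refl))))

coords-lincomb : ∀ r → coords (lincomb rmBasis r) ≡ r
coords-lincomb = from-yes (∀-word? 5 λ r → coords (lincomb rmBasis r) ≟ʷ r)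

rmGenerators-⊆-RM : All RM (fromList rmGenerators)
rmGenerators-⊆-RM = All.map (λ {g} e → coords g , e)
  (from-yes (All.all? (λ g → lincomb rmBasis (coords g) ≟ʷ g) (fromList rmGenerators)))

rmBasis-⊆-rmGenerators : All (Span (fromList rmGenerators)) rmBasis
rmBasis-⊆-rmGenerators = All.map Span-∈ (from-yes (All.all? (_∈? fromList rmGenerators) rmBasis))

normalise : Word 16 → Word 16
normalise t = lincomb rmBasis (coords t) ⊕ t

normalise-⊕ : ∀ t s → normalise (t ⊕ s) ≡ normalise t ⊕ normalise s
normalise-⊕ t s = begin
  lincomb rmBasis (coords (t ⊕ s)) ⊕ (t ⊕ s)
    ≡⟨ cong (λ r → lincomb rmBasis r ⊕ (t ⊕ s)) (coords-⊕ t s) ⟩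
  lincomb rmBasis (coords t ⊕ coords s) ⊕ (t ⊕ s)
    ≡⟨ cong (_⊕ (t ⊕ s)) (lincomb-⊕ rmBasis (coords t) (coords s)) ⟩
  (lincomb rmBasis (coords t) ⊕ lincomb rmBasis (coords s)) ⊕ (t ⊕ s)
    ≡⟨ ⊕-interchange _ _ t s ⟩
  normalise t ⊕ normalise s ∎
  where open ≡-Reasoning

coords-normalise : ∀ t → coords (normalise t) ≡ zeroW
coords-normalise t = begin
  coords (lincomb rmBasis (coords t) ⊕ t)          ≡⟨ coords-⊕ _ t ⟩
  coords (lincomb rmBasis (coords t)) ⊕ coords t   ≡⟨ cong (_⊕ coords t) (coords-lincomb (coords t)) ⟩
  coords t ⊕ coords t                              ≡⟨ ⊕-self (coords t) ⟩
  zeroW                                            ∎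
  where open ≡-Reasoning

extend : Word 11 → Word 16
extend (v₃ ∷ v₅ ∷ v₆ ∷ v₇ ∷ v₉ ∷ v₁₀ ∷ v₁₁ ∷ v₁₂ ∷ v₁₃ ∷ v₁₄ ∷ v₁₅ ∷ []) =
  false ∷ false ∷ false ∷ v₃ ∷ false ∷ v₅ ∷ v₆ ∷ v₇ ∷ false ∷ v₉ ∷ v₁₀ ∷ v₁₁ ∷ v₁₂ ∷ v₁₃ ∷ v₁₄ ∷ v₁₅ ∷ []

coords≡zero⇒extend : ∀ t → coords t ≡ zeroW → ∃[ v ] extend v ≡ t
coords≡zero⇒extend (true ∷ _ ∷ _ ∷ _ ∷ _ ∷ _ ∷ _ ∷ _ ∷ _ ∷ _) ()
coords≡zero⇒extend (false ∷ _ ∷ _ ∷ _ ∷ _ ∷ _ ∷ _ ∷ _ ∷ true ∷ _) ()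
coords≡zero⇒extend (false ∷ _ ∷ _ ∷ _ ∷ true ∷ _ ∷ _ ∷ _ ∷ false ∷ _) ()
coords≡zero⇒extend (false ∷ _ ∷ true ∷ _ ∷ false ∷ _ ∷ _ ∷ _ ∷ false ∷ _) ()
coords≡zero⇒extend (false ∷ true ∷ false ∷ _ ∷ false ∷ _ ∷ _ ∷ _ ∷ false ∷ _) ()
coords≡zero⇒extend (false ∷ false ∷ false ∷ t₃ ∷ false ∷ t₅ ∷ t₆ ∷ t₇ ∷ false ∷ t₉ ∷ t₁₀ ∷ t₁₁ ∷ t₁₂ ∷ t₁₃ ∷ t₁₄ ∷ t₁₅ ∷ []) refl =
  t₃ ∷ t₅ ∷ t₆ ∷ t₇ ∷ t₉ ∷ t₁₀ ∷ t₁₁ ∷ t₁₂ ∷ t₁₃ ∷ t₁₄ ∷ t₁₅ ∷ [] , refl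

-- The parameters [16, 7, 6]

basis : Word 16 → Word 16 → Vec (Word 16) 7
basis h₁ h₂ = rmBasis ++ h₁ ∷ h₂ ∷ []

codeC-basis : ∀ f₁ f₂ → SameCode (codeC f₁ f₂) (Span (basis (truthTable f₁) (truthTable f₂)))
codeC-basis f₁ f₂ = Span-++-cong (fromList rmGenerators) rmBasis _ rmGenerators-⊆-RM rmBasis-⊆-rmGenerators

basis-normalise : ∀ t₁ t₂ → SameCode (Span (basis t₁ t₂)) (Span (basis (normalise t₁) (normalise t₂)))
basis-normalise t₁ t₂ = Span-shift rmBasis t₁ t₂ (coords t₁ , refl) (coords t₂ , refl)

module _ (h₁ h₂ : Word 16) (bent₁ : IsBentW h₁) (bent₂ : IsBentW h₂) (bent₁₂ : IsBentW (h₁ ⊕ h₂)) where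

  private
    B : Vec (Word 16) 7
    B = basis h₁ h₂

  pair-bent : ∀ a₁ a₂ → T (a₁ ∨ a₂) → IsBentW (lincomb (h₁ ∷ h₂ ∷ []) (a₁ ∷ a₂ ∷ []))
  pair-bent true  true  _ = subst IsBentW (cong (h₁ ⊕_) (sym (⊕-identityʳ h₂))) bent₁₂
  pair-bent true  false _ = subst IsBentW (sym (⊕-identityʳ h₁)) bent₁
  pair-bent false true  _ = subst IsBentW (sym (trans (⊕-identityˡ _) (⊕-identityʳ h₂))) bent₂

  -- Outside RM(1,4) every codeword is a bent word plus an affine one, hence bent.
  basis-outside-RM : ∀ r a₁ a₂ → T (a₁ ∨ a₂) → 6 ≤ weight (lincomb B (r ++ a₁ ∷ a₂ ∷ []))
  basis-outside-RM r a₁ a₂ nz =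
    subst (λ c → 6 ≤ weight c) (sym (lincomb-++ rmBasis (h₁ ∷ h₂ ∷ []) r (a₁ ∷ a₂ ∷ [])))
          (IsBentW-6≤weight (lincomb rmBasis r ⊕ pair) (IsBentW-RM pair (r , refl) (pair-bent a₁ a₂ nz)))
    where pair = lincomb (h₁ ∷ h₂ ∷ []) (a₁ ∷ a₂ ∷ [])

  basis-RM : ∀ r → lincomb B (r ++ false ∷ false ∷ []) ≡ lincomb rmBasis r
  basis-RM r = trans (lincomb-++ rmBasis (h₁ ∷ h₂ ∷ []) r (false ∷ false ∷ [])) (⊕-identityʳ _)

  basis-weight : ∀ r a₁ a₂ → lincomb B (r ++ a₁ ∷ a₂ ∷ []) ≢ zeroW → 6 ≤ weight (lincomb B (r ++ a₁ ∷ a₂ ∷ []))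
  basis-weight r false false nz =
    subst (λ c → 6 ≤ weight c) (sym (basis-RM r))
          (ℕ.≤-trans (ℕ.m≤n+m 6 2) (RM-weight⁺ r (λ e → nz (trans (basis-RM r) e))))
  basis-weight r true  a₂   _ = basis-outside-RM r true a₂ _
  basis-weight r false true _ = basis-outside-RM r false true _

  basis-independent : LinIndep B
  basis-independent a e with Vec.splitAt 5 a
  ... | r , false ∷ false ∷ [] , refl = cong (_++ false ∷ false ∷ []) (RM-independent r (trans (sym (basis-RM r)) e))
  ... | r , true  ∷ a₂    ∷ [] , refl = ⊥-elim (weight≢zero e (basis-outside-RM r true a₂ _))
  ... | r , false ∷ true  ∷ [] , refl = ⊥-elim (weight≢zero e (basis-outside-RM r false true _))

  basis-code : Is[ 16 , 7 , 6 ]Code (Span B)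
  basis-code =
    Span-isLinear B ,
    (B , basis-independent , λ c → (λ p → p) , (λ p → p)) ,
    minWeight⇒HasMinDistance (Span-isLinear B) light weight-6 (λ ())
    where
    light : ∀ c → Span B c → c ≢ zeroW → 6 ≤ weight c
    light c (a , refl) with Vec.splitAt 5 a
    ... | r , a₁ ∷ a₂ ∷ [] , refl = basis-weight r a₁ a₂
    h₁∈B : Span B h₁
    h₁∈B = Span-++ʳ rmBasis _ (Span-∈ (here refl))
    weight-6 : ∃[ c ] Span B c × weight c ≡ 6
    weight-6 with IsBentW-weight-6 h₁ bent₁
    ... | inj₁ w≡6 = h₁ , h₁∈B , w≡6
    ... | inj₂ w≡6 = onesW ⊕ h₁ , Span-⊕ B (Span-++ˡ rmBasis _ (Span-∈ (here refl))) h₁∈B , w≡6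

-- Classification of normalised bent words

bentNormalForms : Vec (Word 16) 28
bentNormalForms =
  (false ∷ false ∷ false ∷ false ∷ false ∷ false ∷ true ∷ true ∷ false ∷ true ∷ false ∷ true ∷ false ∷ true ∷ true ∷ false ∷ []) ∷
  (false ∷ false ∷ false ∷ false ∷ false ∷ false ∷ true ∷ true ∷ false ∷ true ∷ false ∷ true ∷ true ∷ false ∷ false ∷ true ∷ []) ∷
  (false ∷ false ∷ false ∷ false ∷ false ∷ false ∷ true ∷ true ∷ false ∷ true ∷ true ∷ false ∷ false ∷ true ∷ false ∷ true ∷ []) ∷
  (false ∷ false ∷ false ∷ false ∷ false ∷ false ∷ true ∷ true ∷ false ∷ true ∷ true ∷ false ∷ true ∷ false ∷ true ∷ false ∷ []) ∷
  (false ∷ false ∷ false ∷ false ∷ false ∷ true ∷ false ∷ true ∷ false ∷ false ∷ true ∷ true ∷ false ∷ true ∷ true ∷ false ∷ []) ∷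
  (false ∷ false ∷ false ∷ false ∷ false ∷ true ∷ false ∷ true ∷ false ∷ false ∷ true ∷ true ∷ true ∷ false ∷ false ∷ true ∷ []) ∷
  (false ∷ false ∷ false ∷ false ∷ false ∷ true ∷ false ∷ true ∷ false ∷ true ∷ true ∷ false ∷ false ∷ false ∷ true ∷ true ∷ []) ∷
  (false ∷ false ∷ false ∷ false ∷ false ∷ true ∷ false ∷ true ∷ false ∷ true ∷ true ∷ false ∷ true ∷ true ∷ false ∷ false ∷ []) ∷
  (false ∷ false ∷ false ∷ false ∷ false ∷ true ∷ true ∷ false ∷ false ∷ false ∷ true ∷ true ∷ false ∷ true ∷ false ∷ true ∷ []) ∷
  (false ∷ false ∷ false ∷ false ∷ false ∷ true ∷ true ∷ false ∷ false ∷ false ∷ true ∷ true ∷ true ∷ false ∷ true ∷ false ∷ []) ∷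
  (false ∷ false ∷ false ∷ false ∷ false ∷ true ∷ true ∷ false ∷ false ∷ true ∷ false ∷ true ∷ false ∷ false ∷ true ∷ true ∷ []) ∷
  (false ∷ false ∷ false ∷ false ∷ false ∷ true ∷ true ∷ false ∷ false ∷ true ∷ false ∷ true ∷ true ∷ true ∷ false ∷ false ∷ []) ∷
  (false ∷ false ∷ false ∷ true ∷ false ∷ false ∷ false ∷ true ∷ false ∷ false ∷ false ∷ true ∷ true ∷ true ∷ true ∷ false ∷ []) ∷
  (false ∷ false ∷ false ∷ true ∷ false ∷ false ∷ false ∷ true ∷ false ∷ false ∷ true ∷ false ∷ true ∷ true ∷ false ∷ true ∷ []) ∷
  (false ∷ false ∷ false ∷ true ∷ false ∷ false ∷ false ∷ true ∷ false ∷ true ∷ false ∷ false ∷ true ∷ false ∷ true ∷ true ∷ []) ∷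
  (false ∷ false ∷ false ∷ true ∷ false ∷ false ∷ false ∷ true ∷ false ∷ true ∷ true ∷ true ∷ true ∷ false ∷ false ∷ false ∷ []) ∷
  (false ∷ false ∷ false ∷ true ∷ false ∷ false ∷ true ∷ false ∷ false ∷ false ∷ false ∷ true ∷ true ∷ true ∷ false ∷ true ∷ []) ∷
  (false ∷ false ∷ false ∷ true ∷ false ∷ false ∷ true ∷ false ∷ false ∷ false ∷ true ∷ false ∷ true ∷ true ∷ true ∷ false ∷ []) ∷
  (false ∷ false ∷ false ∷ true ∷ false ∷ false ∷ true ∷ false ∷ false ∷ true ∷ false ∷ false ∷ false ∷ true ∷ true ∷ true ∷ []) ∷
  (false ∷ false ∷ false ∷ true ∷ false ∷ false ∷ true ∷ false ∷ false ∷ true ∷ true ∷ true ∷ false ∷ true ∷ false ∷ false ∷ []) ∷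
  (false ∷ false ∷ false ∷ true ∷ false ∷ true ∷ false ∷ false ∷ false ∷ false ∷ false ∷ true ∷ true ∷ false ∷ true ∷ true ∷ []) ∷
  (false ∷ false ∷ false ∷ true ∷ false ∷ true ∷ false ∷ false ∷ false ∷ false ∷ true ∷ false ∷ false ∷ true ∷ true ∷ true ∷ []) ∷
  (false ∷ false ∷ false ∷ true ∷ false ∷ true ∷ false ∷ false ∷ false ∷ true ∷ false ∷ false ∷ true ∷ true ∷ true ∷ false ∷ []) ∷
  (false ∷ false ∷ false ∷ true ∷ false ∷ true ∷ false ∷ false ∷ false ∷ true ∷ true ∷ true ∷ false ∷ false ∷ true ∷ false ∷ []) ∷
  (false ∷ false ∷ false ∷ true ∷ false ∷ true ∷ true ∷ true ∷ false ∷ false ∷ false ∷ true ∷ true ∷ false ∷ false ∷ false ∷ []) ∷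
  (false ∷ false ∷ false ∷ true ∷ false ∷ true ∷ true ∷ true ∷ false ∷ false ∷ true ∷ false ∷ false ∷ true ∷ false ∷ false ∷ []) ∷
  (false ∷ false ∷ false ∷ true ∷ false ∷ true ∷ true ∷ true ∷ false ∷ true ∷ false ∷ false ∷ false ∷ false ∷ true ∷ false ∷ []) ∷
  (false ∷ false ∷ false ∷ true ∷ false ∷ true ∷ true ∷ true ∷ false ∷ true ∷ true ∷ true ∷ true ∷ true ∷ true ∷ false ∷ []) ∷ []

classification : ∀ v → IsBentW (extend v) → extend v ∈ bentNormalForms
classification = from-yes (∀-word? 11 λ v → bentW? (extend v) →-dec extend v ∈? bentNormalForms)

normalise-∈ : ∀ t → IsBentW t → normalise t ∈ bentNormalForms
normalise-∈ t bent with coords≡zero⇒extend (normalise t) (coords-normalise t)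
... | v , v≡ = subst (_∈ bentNormalForms) v≡
  (classification v (subst IsBentW (sym v≡) (IsBentW-RM t (coords t , refl) bent)))

-- Equivalence certificates

digits : (b : ℕ) .{{_ : NonZero b}} (k : ℕ) → ℕ → Vec ℕ k
digits b zero    m = []
digits b (suc k) m = m % b ∷ digits b k (m / b)

permutationOf : ℕ → Vec (Fin 16) 16
permutationOf m = Vec.map (_mod 16) (digits 16 16 m)

matrixOf : ℕ → Vec (Vec Bool 7) 7
matrixOf m = Vec.map (λ row → Vec.map (_≡ᵇ 1) (digits 2 7 row)) (digits 128 7 m)

-- A permutation p with inverse q (base-16 digits, least significant first) and two 7 × 7
-- matrices (rows in base 128, each row in binary) expressing the permuted basis B in the
-- reference basis and conversely.
record Certificate : Set where
  constructor certificate
  field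
    p q toReference fromReference : ℕ

permuteBy : ∀ {n} → Vec (Fin n) n → Word n → Word n
permuteBy p c = tabulate (λ i → lookup c (lookup p i))

Inverses : ∀ {n} → Vec (Fin n) n → Vec (Fin n) n → Set
Inverses p q = (∀ i → lookup p (lookup q i) ≡ i) × (∀ i → lookup q (lookup p i) ≡ i)

Certifies : Vec (Word 16) 7 → Vec (Word 16) 7 → Certificate → Set
Certifies B R (certificate p q toRef fromRef) =
  Inverses (permutationOf p) (permutationOf q) ×
  (∀ k → lincomb R (lookup (matrixOf toRef) k) ≡ permuteBy (permutationOf p) (lookup B k)) ×
  (∀ k → lincomb (Vec.map (permuteBy (permutationOf p)) B) (lookup (matrixOf fromRef) k) ≡ lookup R k)

certifies? : ∀ B R → Decidable (Certifies B R)
certifies? B R (certificate p q toRef fromRef) =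
  ((all? λ i → lookup P (lookup Q i) ≟ᶠ i) ×-dec (all? λ i → lookup Q (lookup P i) ≟ᶠ i)) ×-dec
  (all? λ k → lincomb R (lookup (matrixOf toRef) k) ≟ʷ permuteBy P (lookup B k)) ×-dec
  (all? λ k → lincomb (Vec.map (permuteBy P) B) (lookup (matrixOf fromRef) k) ≟ʷ lookup R k)
  where
  P = permutationOf p
  Q = permutationOf q

Certifies⇒Equivalent : ∀ B R c → Certifies B R c → Equivalent (Span B) (Span R)
Certifies⇒Equivalent B R (certificate p q toRef fromRef) ((pq , qp) , into , onto) =
  Equivalent-respʳ (Span-permuteW σ B) (sameSpan (Vec.map (permuteW σ) B) R
    (lookup⁻ λ k → lookup (matrixOf toRef) k , trans (into k) (sym (lookup-map k (permuteW σ) B)))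
    (lookup⁻ λ k → lookup (matrixOf fromRef) k , onto k))
  where
  -- permuteW σ reduces to permuteBy (permutationOf p).
  σ : Permutation′ 16
  σ = permutation (lookup (permutationOf p)) (lookup (permutationOf q)) pq qp

referenceBasis : Vec (Word 16) 7
referenceBasis = basis (lookup bentNormalForms (# 0)) (lookup bentNormalForms (# 6))

certificates : Vec (Vec (Maybe Certificate) 28) 28
certificates =
  (nothing ∷ nothing ∷ nothing ∷ nothing ∷ nothing ∷ nothing ∷ just (certificate 17848844570815808640 17848844570815808640 282575033731073 282575033731073) ∷ just (certificate 4277714969153562240 11801092942831351440 291714732591361 353772715051009) ∷ just (certificate 17848844570815808640 17848844570815808640 423312522086401 423312522086401) ∷ just (certificate 4277714969153562240 11801092942831351440 458840500013313 494510203406337) ∷ nothing ∷ nothing ∷ nothing ∷ nothing ∷ just (certificate 17858377336630846080 17858377336630846080 282575042054145 282575042054145) ∷ just (certificate 12958535707701601920 12958535707701601920 282849920092161 282849920092161) ∷ just (certificate 17858377336630846080 17858377336630846080 423312530409473 423312530409473) ∷ just (certificate 12958535707701601920 12958535707701601920 458771780536321 423587408447489) ∷ nothing ∷ nothing ∷ nothing ∷ nothing ∷ just (certificate 9177556598082806400 16700934571760595600 291439854553345 353497837012993) ∷ just (certificate 9168023832267768960 16691401805945558160 291439846230273 353497828689921) ∷ just (certificate 9177556598082806400 16700934571760595600 423381249886465 494235325368321) ∷ just (certificate 9168023832267768960 16691401805945558160 423381241563393 494235317045249) ∷ nothing ∷ nothing ∷ []) ∷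
  (nothing ∷ nothing ∷ nothing ∷ nothing ∷ nothing ∷ nothing ∷ just (certificate 1832504536372410240 4370031921962707440 188293534910721 530246495702017) ∷ just (certificate 16590032319126199680 10314874141688519280 320029291941121 390881266172929) ∷ just (certificate 16590032319126199680 10314874141688519280 188087896608001 530519242900481) ∷ just (certificate 1832504536372410240 4370031921962707440 293846651177217 390608518974465) ∷ nothing ∷ nothing ∷ just (certificate 12939395702483886720 13228747562238141120 284774065342465 284774065571841) ∷ just (certificate 16614239539074234240 4581704334278159040 320235462952961 319958437661697) ∷ nothing ∷ nothing ∷ nothing ∷ nothing ∷ just (certificate 12939395702483886720 13228747562238141120 144036576987137 424412042299393) ∷ just (certificate 16614239539074234240 4581704334278159040 144313602508801 459596414389249) ∷ just (certificate 1818149678488003200 9774433939941020400 293638882035969 355147138271233) ∷ just (certificate 12929543340420259200 13557515351670188400 188018640227585 530796251513857) ∷ nothing ∷ nothing ∷ nothing ∷ nothing ∷ just (certificate 1818149678488003200 9774433939941020400 144105300658433 494785114998785) ∷ just (certificate 12929543340420259200 13557515351670188400 328756128582913 391158274786305) ∷ []) ∷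
  (nothing ∷ nothing ∷ nothing ∷ nothing ∷ just (certificate 15389353753742328960 13255102855962068160 284774061180929 284774057248769) ∷ just (certificate 16580462024459583360 3424261569407908560 318105159175425 318313465187329) ∷ nothing ∷ nothing ∷ nothing ∷ nothing ∷ just (certificate 15389353753742328960 13255102855962068160 144036572825601 424412033976321) ∷ just (certificate 16580462024459583360 3424261569407908560 432454368464129 459050953542657) ∷ nothing ∷ nothing ∷ just (certificate 7967196311114252160 3356706544220928960 458773928053761 423589556063233) ∷ just (certificate 16633379546573616000 9211334108670864000 317761561626625 317759414144001) ∷ just (certificate 16633379546573616000 9211334108670864000 458499049981953 458496902499329) ∷ just (certificate 7967196311114252160 3356706544220928960 282852067609601 282852067707905) ∷ nothing ∷ nothing ∷ just (certificate 7952558808025576320 9134771746792287120 458567769458945 494512350759937) ∷ just (certificate 1827682444298601600 9782845203895465200 293638873712897 355147129948161) ∷ nothing ∷ nothing ∷ nothing ∷ nothing ∷ just (certificate 1827682444298601600 9782845203895465200 144105292335361 494785106675713) ∷ just (certificate 7952558808025576320 9134771746792287120 326626374125825 353774862404609) ∷ []) ∷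
  (nothing ∷ nothing ∷ nothing ∷ nothing ∷ just (certificate 4282500116486870400 12409079923491535200 186987848075521 178948235658241) ∷ just (certificate 1837289683705718400 14097823612525647600 293845040564481 355422016309249) ∷ nothing ∷ nothing ∷ nothing ∷ nothing ∷ just (certificate 1837289683705718400 14097823612525647600 188291924297985 495059993036801) ∷ just (certificate 4282500116486870400 12409079923491535200 459666731763969 180047747286017) ∷ just (certificate 7986336318613633920 7986336318613633920 459598561610753 144313602345985) ∷ just (certificate 17839237329131464320 17552137234822768320 285048943380481 285048943609857) ∷ nothing ∷ nothing ∷ nothing ∷ nothing ∷ just (certificate 17839237329131464320 17552137234822768320 179495827113985 424686920337409) ∷ just (certificate 7986336318613633920 7986336318613633920 178123584900097 143214090718209) ∷ nothing ∷ nothing ∷ just (certificate 7942989095192810880 10247319116501539680 459598549190913 144863391974401) ∷ just (certificate 15379389389235043200 7851226268176759200 186987864722689 248767223761921) ∷ just (certificate 15379389389235043200 7851226268176759200 459666748411137 249866735389697) ∷ just (certificate 7942989095192810880 10247319116501539680 178123572480257 143763880346625) ∷ nothing ∷ nothing ∷ []) ∷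
  (nothing ∷ nothing ∷ just (certificate 15389353753742328960 13255102855962068160 424412037908481 144036568893441) ∷ just (certificate 4282500116486870400 12409079923491535200 291716330621185 318586212385793) ∷ nothing ∷ nothing ∷ nothing ∷ nothing ∷ nothing ∷ nothing ∷ just (certificate 15389353753742328960 13255102855962068160 142937061197825 142937057265665) ∷ just (certificate 4282500116486870400 12409079923491535200 458842098043137 459323700741121) ∷ nothing ∷ just (certificate 17863162483964154240 18263707487941470240 282576640083969 282575058830337) ∷ nothing ∷ just (certificate 12963320855034910080 13634077713548765280 282851518121985 283124814906369) ∷ nothing ∷ just (certificate 9182341745416114560 17038709697884240160 291441452583169 318036456309761) ∷ nothing ∷ just (certificate 10508503182846641280 10940287968765715680 424480757417985 214955102439425) ∷ just (certificate 17863162483964154240 18263707487941470240 423314128439297 423312547185665) ∷ nothing ∷ just (certificate 12963320855034910080 13634077713548765280 458773378566145 423862303261697) ∷ nothing ∷ just (certificate 9182341745416114560 17038709697884240160 423382847916289 458773944665089) ∷ nothing ∷ just (certificate 10508503182846641280 10940287968765715680 151801873729537 213855590811649) ∷ nothing ∷ []) ∷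
  (nothing ∷ nothing ∷ just (certificate 16580462024459583360 3424261569407908560 187194555993345 178675488459777) ∷ just (certificate 1837289683705718400 14097823612525647600 459665137928449 214684527953921) ∷ nothing ∷ nothing ∷ nothing ∷ nothing ∷ nothing ∷ nothing ∷ just (certificate 1837289683705718400 14097823612525647600 186986254240001 213585016326145) ∷ just (certificate 16580462024459583360 3424261569407908560 433485160615169 179775000087553) ∷ just (certificate 9216119256004172160 17106264723071219760 424413640068097 144040888697857) ∷ nothing ∷ just (certificate 1866282046960467840 3289151518971033840 459872906972161 214409633139713) ∷ nothing ∷ just (certificate 16609172326625581440 14944503916081224240 433278989438209 179225277563905) ∷ nothing ∷ just (certificate 9158416590583424640 16394694469952517840 186917530601729 143765994407937) ∷ nothing ∷ nothing ∷ just (certificate 9216119256004172160 17106264723071219760 142938663357441 142941377070081) ∷ nothing ∷ just (certificate 1866282046960467840 3289151518971033840 143213558172673 213310121511937) ∷ nothing ∷ just (certificate 16609172326625581440 14944503916081224240 143007919705345 178125765936129) ∷ nothing ∷ just (certificate 9158416590583424640 16394694469952517840 468392507312385 144865506035713) ∷ []) ∷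
  (just (certificate 17848844570815808640 17848844570815808640 142937057003521 142937057003521) ∷ just (certificate 1832504536372410240 4370031921962707440 458842114820353 529146984074241) ∷ nothing ∷ nothing ∷ nothing ∷ nothing ∷ nothing ∷ nothing ∷ just (certificate 17848844570815808640 17848844570815808640 424412033714177 144036568631297) ∷ just (certificate 1832504536372410240 4370031921962707440 291716347398401 388409495718913) ∷ nothing ∷ nothing ∷ nothing ∷ just (certificate 10513325274920449920 4446594283841284320 318035906988033 353493559086081) ∷ nothing ∷ just (certificate 15413166903849694080 9076224058233989280 317761028950017 352943803010049) ∷ just (certificate 6732346165301654400 8999661696355412400 458567236782337 459327995448321) ∷ nothing ∷ just (certificate 12967993999920120960 15534029683619456160 143005776513025 213305834735617) ∷ nothing ∷ just (certificate 15413166903849694080 9076224058233989280 458498517305345 493681291365377) ∷ nothing ∷ just (certificate 10513325274920449920 4446594283841284320 423589023254529 494231047441409) ∷ nothing ∷ nothing ∷ just (certificate 12967993999920120960 15534029683619456160 433276846245889 214405346363393) ∷ nothing ∷ just (certificate 6732346165301654400 8999661696355412400 326625841449217 318590507092993) ∷ []) ∷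
  (just (certificate 4277714969153562240 11801092942831351440 186986250045697 214134738323457) ∷ just (certificate 16590032319126199680 10314874141688519280 433485148032257 250143777817601) ∷ nothing ∷ nothing ∷ nothing ∷ nothing ∷ nothing ∷ nothing ∷ just (certificate 16590032319126199680 10314874141688519280 187194543410433 249044266189825) ∷ just (certificate 4277714969153562240 11801092942831351440 459665133734145 215234249951233) ∷ nothing ∷ nothing ∷ just (certificate 6766123675889712000 7918781293363738800 459598028934145 144590644513793) ∷ nothing ∷ just (certificate 4316277627074928000 12476634948678514800 424688518106113 214959388951553) ∷ nothing ∷ nothing ∷ just (certificate 6717991305135580800 9504222085404481200 459596418484481 144865539328001) ∷ nothing ∷ just (certificate 16599602031958965120 8053891343800613520 186988397399297 249044232375297) ∷ nothing ∷ just (certificate 4316277627074928000 12476634948678514800 178397913484289 213859877323777) ∷ nothing ∷ just (certificate 6766123675889712000 7918781293363738800 178123052223489 143491132886017) ∷ just (certificate 16599602031958965120 8053891343800613520 459667281087745 250143744003073) ∷ nothing ∷ just (certificate 6717991305135580800 9504222085404481200 178121441773825 143766027700225) ∷ nothing ∷ []) ∷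
  (just (certificate 17848844570815808640 17848844570815808640 144036568631297 424412033714177) ∷ just (certificate 16590032319126199680 10314874141688519280 432454355881217 529419731272705) ∷ nothing ∷ nothing ∷ nothing ∷ nothing ∷ just (certificate 17848844570815808640 17848844570815808640 284774056986625 284774056986625) ∷ just (certificate 16590032319126199680 10314874141688519280 318105146592513 388682242917377) ∷ nothing ∷ nothing ∷ nothing ∷ nothing ∷ nothing ∷ just (certificate 16642949841240232320 16101946680951474720 291373269977089 317759447696385) ∷ just (certificate 7976766605780868480 11395754544680192880 432385636404225 494512384574465) ∷ nothing ∷ nothing ∷ just (certificate 7962129102692192640 14876948890894244640 282645896431873 282852100998145) ∷ just (certificate 4287173261372081280 14376586918749205680 152901381163265 424966118049793) ∷ nothing ∷ just (certificate 7962129102692192640 14876948890894244640 432179477809409 423589589353473) ∷ nothing ∷ nothing ∷ just (certificate 4287173261372081280 14376586918749205680 284842776496385 285328141322241) ∷ just (certificate 16642949841240232320 16101946680951474720 432110758332417 458496936051713) ∷ nothing ∷ nothing ∷ just (certificate 7976766605780868480 11395754544680192880 326832520137729 353774896219137) ∷ []) ∷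
  (just (certificate 4277714969153562240 11801092942831351440 188291920103681 495609715034113) ∷ just (certificate 1832504536372410240 4370031921962707440 459666748541185 249871030619137) ∷ nothing ∷ nothing ∷ nothing ∷ nothing ∷ just (certificate 1832504536372410240 4370031921962707440 186987864852737 248771518991361) ∷ just (certificate 4277714969153562240 11801092942831351440 293845036370177 355971738306561) ∷ nothing ∷ nothing ∷ nothing ∷ nothing ∷ just (certificate 7995906613280250240 16025384319072897840 433210269961217 144317930865665) ∷ nothing ∷ nothing ∷ just (certificate 15398812043683620480 10661664850274731680 293845040596993 355417721079809) ∷ just (certificate 17829384969349503360 18187145126062893360 424482359545089 179502286177281) ∷ nothing ∷ nothing ∷ just (certificate 7933418800526194560 4505141972399582160 151735305996545 143768141761537) ∷ nothing ∷ just (certificate 17829384969349503360 18187145126062893360 151803475856641 178402774549505) ∷ just (certificate 7933418800526194560 4505141972399582160 433210282707201 144867653389313) ∷ nothing ∷ nothing ∷ just (certificate 7995906613280250240 16025384319072897840 151735293250561 143218419237889) ∷ just (certificate 15398812043683620480 10661664850274731680 188291924330497 495055697807361) ∷ nothing ∷ []) ∷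
  (nothing ∷ nothing ∷ just (certificate 15389353753742328960 13255102855962068160 423312526280705 423312522348545) ∷ just (certificate 1837289683705718400 14097823612525647600 458840504207617 493960481409025) ∷ just (certificate 15389353753742328960 13255102855962068160 282575037925377 282575033993217) ∷ just (certificate 1837289683705718400 14097823612525647600 291714736785665 353222993053697) ∷ nothing ∷ nothing ∷ nothing ∷ nothing ∷ nothing ∷ nothing ∷ nothing ∷ just (certificate 10518110422253758080 15255266377395898080 291646017308673 353768453900289) ∷ just (certificate 15417952051183002240 15561506479203975840 291371139270657 352943819786241) ∷ nothing ∷ just (certificate 6737131312634962560 14404063714333725360 432177347102977 423866614745089) ∷ nothing ∷ nothing ∷ just (certificate 6708533015194289280 12097660091091817680 432177338779905 423866573129729) ∷ nothing ∷ just (certificate 6708533015194289280 12097660091091817680 282643757402369 283129084774401) ∷ just (certificate 6737131312634962560 14404063714333725360 282643765725441 283129126389761) ∷ nothing ∷ just (certificate 15417952051183002240 15561506479203975840 432108627625985 493681308141569) ∷ nothing ∷ nothing ∷ just (certificate 10518110422253758080 15255266377395898080 467567877752833 494505942255617) ∷ []) ∷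
  (nothing ∷ nothing ∷ just (certificate 16580462024459583360 3424261569407908560 188087909190913 460150465170433) ∷ just (certificate 4282500116486870400 12409079923491535200 293846634400001 320785235641345) ∷ just (certificate 4282500116486870400 12409079923491535200 188293518133505 460423212368897) ∷ just (certificate 16580462024459583360 3424261569407908560 320029304524033 320512488442881) ∷ nothing ∷ nothing ∷ nothing ∷ nothing ∷ nothing ∷ nothing ∷ just (certificate 10498970417036042880 10931876704811270880 293570162558977 355692599117825) ∷ nothing ∷ nothing ∷ just (certificate 16623809833740850560 11472316906558769760 293847171303425 320508227027969) ∷ nothing ∷ just (certificate 10479547760305799040 3221596493784054240 293571773271297 391153979821057) ∷ just (certificate 4258574963935847040 12071304797367890640 152901389486337 424966093080577) ∷ nothing ∷ just (certificate 4258574963935847040 12071304797367890640 284842784819457 285328116353025) ∷ nothing ∷ nothing ∷ just (certificate 10479547760305799040 3221596493784054240 152834284915969 530791956548609) ∷ nothing ∷ just (certificate 16623809833740850560 11472316906558769760 188294055036929 460146203755521) ∷ just (certificate 10498970417036042880 10931876704811270880 152832674203649 495330575845377) ∷ nothing ∷ []) ∷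
  (nothing ∷ just (certificate 12939395702483886720 13228747562238141120 424412042070017 144036577216513) ∷ nothing ∷ just (certificate 7986336318613633920 7986336318613633920 285051090701313 285051090701313) ∷ nothing ∷ just (certificate 9216119256004172160 17106264723071219760 284775663340545 284778377053185) ∷ nothing ∷ just (certificate 6766123675889712000 7918781293363738800 285050558024705 285328132869121) ∷ nothing ∷ just (certificate 7995906613280250240 16025384319072897840 284844919688193 285055419220993) ∷ nothing ∷ just (certificate 10498970417036042880 10931876704811270880 424480765741057 214955110762497) ∷ nothing ∷ nothing ∷ nothing ∷ nothing ∷ nothing ∷ nothing ∷ just (certificate 12939395702483886720 13228747562238141120 142937065359361 142937065588737) ∷ just (certificate 7986336318613633920 7986336318613633920 179497974434817 424689067428865) ∷ nothing ∷ just (certificate 9216119256004172160 17106264723071219760 144038174985217 424416353780737) ∷ nothing ∷ just (certificate 6766123675889712000 7918781293363738800 179497441758209 424966109596673) ∷ nothing ∷ just (certificate 7995906613280250240 16025384319072897840 152903524355073 424693395948545) ∷ just (certificate 10498970417036042880 10931876704811270880 151801882052609 213855599134721) ∷ nothing ∷ []) ∷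
  (nothing ∷ just (certificate 16614239539074234240 4581704334278159040 459873439680513 179220949306369) ∷ nothing ∷ just (certificate 17839237329131464320 17552137234822768320 459596414289921 144311455254529) ∷ just (certificate 17863162483964154240 18263707487941470240 142938663356417 142937082102785) ∷ nothing ∷ just (certificate 10513325274920449920 4446594283841284320 178397930260481 213855582358529) ∷ nothing ∷ just (certificate 16642949841240232320 16101946680951474720 143007919704065 178121470968833) ∷ nothing ∷ just (certificate 10518110422253758080 15255266377395898080 178190161217537 214130477172737) ∷ nothing ∷ nothing ∷ nothing ∷ nothing ∷ nothing ∷ nothing ∷ nothing ∷ just (certificate 17839237329131464320 17552137234822768320 178121437579265 143211943626753) ∷ just (certificate 16614239539074234240 4581704334278159040 143214090881025 178121437678593) ∷ just (certificate 17863162483964154240 18263707487941470240 424413640067073 144036593730561) ∷ nothing ∷ just (certificate 10513325274920449920 4446594283841284320 424688534882305 214955093986305) ∷ nothing ∷ just (certificate 16642949841240232320 16101946680951474720 433278989436929 179220982596609) ∷ nothing ∷ nothing ∷ just (certificate 10518110422253758080 15255266377395898080 468461230950401 215229988800513) ∷ []) ∷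
  (just (certificate 17858377336630846080 17858377336630846080 142937065326593 142937065326593) ∷ nothing ∷ just (certificate 7967196311114252160 3356706544220928960 179497974598657 424689067691009) ∷ nothing ∷ nothing ∷ just (certificate 1866282046960467840 3289151518971033840 320234930244609 355147121495041) ∷ nothing ∷ just (certificate 4316277627074928000 12476634948678514800 319960035560449 355696877306881) ∷ just (certificate 7976766605780868480 11395754544680192880 179291803585537 495611896202241) ∷ nothing ∷ just (certificate 15417952051183002240 15561506479203975840 143005788997633 213305843058689) ∷ nothing ∷ nothing ∷ nothing ∷ nothing ∷ nothing ∷ just (certificate 17858377336630846080 17858377336630846080 424412042037249 144036576954369) ∷ just (certificate 7967196311114252160 3356706544220928960 285051090865153 285051090963457) ∷ nothing ∷ nothing ∷ nothing ∷ just (certificate 4316277627074928000 12476634948678514800 179222547205121 495334854034433) ∷ nothing ∷ just (certificate 1866282046960467840 3289151518971033840 144313069800449 494785098222593) ∷ just (certificate 15417952051183002240 15561506479203975840 433276858730497 214405354686465) ∷ nothing ∷ nothing ∷ just (certificate 7976766605780868480 11395754544680192880 328825384963073 355973919474689) ∷ []) ∷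
  (just (certificate 12958535707701601920 12958535707701601920 178121437546497 143211943364609) ∷ nothing ∷ just (certificate 16633379546573616000 9211334108670864000 143214090717185 178121437416449) ∷ nothing ∷ just (certificate 12963320855034910080 13634077713548765280 178123035576321 143486838178817) ∷ nothing ∷ just (certificate 15413166903849694080 9076224058233989280 143213558040577 213305826282497) ∷ nothing ∷ nothing ∷ just (certificate 15398812043683620480 10661664850274731680 459665137960961 214680232724481) ∷ nothing ∷ just (certificate 16623809833740850560 11472316906558769760 459667268667393 179770738672641) ∷ nothing ∷ nothing ∷ nothing ∷ nothing ∷ just (certificate 16633379546573616000 9211334108670864000 459873439516673 179220949044225) ∷ just (certificate 12958535707701601920 12958535707701601920 459596414257153 144311454992385) ∷ nothing ∷ nothing ∷ just (certificate 15413166903849694080 9076224058233989280 459872906840065 214405337910273) ∷ nothing ∷ just (certificate 12963320855034910080 13634077713548765280 459598012286977 144586349806593) ∷ nothing ∷ nothing ∷ just (certificate 16623809833740850560 11472316906558769760 186988384978945 178671227044865) ∷ just (certificate 15398812043683620480 10661664850274731680 186986254272513 213580721096705) ∷ nothing ∷ []) ∷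
  (just (certificate 17858377336630846080 17858377336630846080 144036576954369 424412042037249) ∷ nothing ∷ just (certificate 16633379546573616000 9211334108670864000 144313602344961 459596414127105) ∷ nothing ∷ nothing ∷ just (certificate 16609172326625581440 14944503916081224240 293641012710657 319962765919233) ∷ just (certificate 6732346165301654400 8999661696355412400 153109162690817 460427507076097) ∷ nothing ∷ nothing ∷ just (certificate 17829384969349503360 18187145126062893360 293571756363009 320239774532609) ∷ just (certificate 6737131312634962560 14404063714333725360 152901393647873 424966126372865) ∷ nothing ∷ nothing ∷ nothing ∷ just (certificate 17858377336630846080 17858377336630846080 284774065309697 284774065309697) ∷ just (certificate 16633379546573616000 9211334108670864000 320235462789121 319958437399553) ∷ nothing ∷ nothing ∷ nothing ∷ nothing ∷ nothing ∷ just (certificate 17829384969349503360 18187145126062893360 152834268007681 459877751260161) ∷ just (certificate 6737131312634962560 14404063714333725360 284842788980993 285328149645313) ∷ nothing ∷ nothing ∷ just (certificate 16609172326625581440 14944503916081224240 144107431333121 459600742646785) ∷ nothing ∷ just (certificate 6732346165301654400 8999661696355412400 329031023134977 320789530348545) ∷ []) ∷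
  (just (certificate 12958535707701601920 12958535707701601920 179495827081217 424686920075265) ∷ nothing ∷ just (certificate 7967196311114252160 3356706544220928960 178123585063937 143214090980353) ∷ nothing ∷ just (certificate 9182341745416114560 17038709697884240160 151803475855617 178398479582209) ∷ nothing ∷ nothing ∷ just (certificate 6717991305135580800 9504222085404481200 285048947575041 285603027683329) ∷ just (certificate 7962129102692192640 14876948890894244640 151735293249793 143214124270593) ∷ nothing ∷ nothing ∷ just (certificate 10479547760305799040 3221596493784054240 424482376453377 250416491465729) ∷ nothing ∷ nothing ∷ just (certificate 7967196311114252160 3356706544220928960 459598561774593 144313602608129) ∷ just (certificate 12958535707701601920 12958535707701601920 285048943347713 285048943347713) ∷ nothing ∷ nothing ∷ nothing ∷ nothing ∷ just (certificate 7962129102692192640 14876948890894244640 433210269960449 144313635898369) ∷ nothing ∷ nothing ∷ just (certificate 10479547760305799040 3221596493784054240 151803492764929 249316979837953) ∷ just (certificate 9182341745416114560 17038709697884240160 424482359544065 179497991209985) ∷ nothing ∷ just (certificate 6717991305135580800 9504222085404481200 179495831308545 425241004410881) ∷ nothing ∷ []) ∷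
  (nothing ∷ just (certificate 12939395702483886720 13228747562238141120 423312530442241 423312530671617) ∷ nothing ∷ just (certificate 17839237329131464320 17552137234822768320 458771780569089 423587408709633) ∷ nothing ∷ just (certificate 9158416590583424640 16394694469952517840 282918639601921 283403971135489) ∷ just (certificate 12967993999920120960 15534029683619456160 291371126786049 352943811463169) ∷ nothing ∷ just (certificate 4287173261372081280 14376586918749205680 432177334618369 423866606422017) ∷ nothing ∷ nothing ∷ just (certificate 4258574963935847040 12071304797367890640 432177342941441 423866581452801) ∷ just (certificate 12939395702483886720 13228747562238141120 282575042086913 282575042316289) ∷ just (certificate 17839237329131464320 17552137234822768320 282849920124929 282849920354305) ∷ nothing ∷ nothing ∷ nothing ∷ nothing ∷ nothing ∷ nothing ∷ just (certificate 4258574963935847040 12071304797367890640 282643761563905 283129093097473) ∷ nothing ∷ nothing ∷ just (certificate 4287173261372081280 14376586918749205680 282643753240833 283129118066689) ∷ nothing ∷ just (certificate 12967993999920120960 15534029683619456160 432108615141377 493681299818497) ∷ nothing ∷ just (certificate 9158416590583424640 16394694469952517840 467636593068289 424141459490817) ∷ []) ∷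
  (nothing ∷ just (certificate 16614239539074234240 4581704334278159040 458499050145793 458496902761473) ∷ nothing ∷ just (certificate 7986336318613633920 7986336318613633920 282852067445761 282852067445761) ∷ just (certificate 10508503182846641280 10940287968765715680 293570154235905 355692590794753) ∷ nothing ∷ nothing ∷ just (certificate 16599602031958965120 8053891343800613520 291716879944961 388682209102849) ∷ nothing ∷ just (certificate 7933418800526194560 4505141972399582160 282645909178625 283406118489089) ∷ just (certificate 6708533015194289280 12097660091091817680 152901385324801 424966084757505) ∷ nothing ∷ just (certificate 7986336318613633920 7986336318613633920 458773927889921 423589555801089) ∷ just (certificate 16614239539074234240 4581704334278159040 317761561790465 317759414406145) ∷ nothing ∷ nothing ∷ nothing ∷ nothing ∷ nothing ∷ nothing ∷ nothing ∷ just (certificate 6708533015194289280 12097660091091817680 284842780657921 285328108029953) ∷ just (certificate 7933418800526194560 4505141972399582160 432179490556161 424143606844417) ∷ nothing ∷ just (certificate 16599602031958965120 8053891343800613520 458842647366913 529419697458177) ∷ nothing ∷ just (certificate 10508503182846641280 10940287968765715680 152832665880577 495330567522305) ∷ nothing ∷ []) ∷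
  (nothing ∷ just (certificate 1818149678488003200 9774433939941020400 433276858763521 214409649915905) ∷ just (certificate 7952558808025576320 9134771746792287120 153109695367425 495611862387713) ∷ nothing ∷ just (certificate 17863162483964154240 18263707487941470240 144038174984193 424412058813441) ∷ nothing ∷ just (certificate 15413166903849694080 9076224058233989280 144313069668353 494780802993153) ∷ nothing ∷ just (certificate 7962129102692192640 14876948890894244640 152903524354305 424689100981249) ∷ nothing ∷ nothing ∷ just (certificate 4258574963935847040 12071304797367890640 433208135092481 144590627997697) ∷ nothing ∷ just (certificate 17863162483964154240 18263707487941470240 284775663339521 284774082085889) ∷ nothing ∷ just (certificate 15413166903849694080 9076224058233989280 320234930112513 355142826265601) ∷ nothing ∷ just (certificate 7962129102692192640 14876948890894244640 284844919687425 285051124253697) ∷ just (certificate 4258574963935847040 12071304797367890640 151733158381825 143491116369921) ∷ nothing ∷ nothing ∷ nothing ∷ nothing ∷ nothing ∷ nothing ∷ nothing ∷ just (certificate 1818149678488003200 9774433939941020400 143005789030657 213310138288129) ∷ just (certificate 7952558808025576320 9134771746792287120 329031555811585 355973885660161) ∷ []) ∷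
  (nothing ∷ just (certificate 12929543340420259200 13557515351670188400 423657725955329 529696739886081) ∷ just (certificate 1827682444298601600 9782845203895465200 433276850440449 214409641592833) ∷ nothing ∷ nothing ∷ just (certificate 9216119256004172160 17106264723071219760 282576640084993 282579353797633) ∷ nothing ∷ just (certificate 4316277627074928000 12476634948678514800 318035890211841 353497854051329) ∷ nothing ∷ just (certificate 17829384969349503360 18187145126062893360 291441452584193 318040751277057) ∷ just (certificate 6708533015194289280 12097660091091817680 151733154220289 143491108046849) ∷ nothing ∷ just (certificate 9216119256004172160 17106264723071219760 423314128440321 423316842152961) ∷ nothing ∷ just (certificate 4316277627074928000 12476634948678514800 423589006478337 494235342406657) ∷ nothing ∷ just (certificate 17829384969349503360 18187145126062893360 423382847917313 458778239632385) ∷ nothing ∷ nothing ∷ just (certificate 6708533015194289280 12097660091091817680 433208130930945 144590619674625) ∷ nothing ∷ nothing ∷ nothing ∷ nothing ∷ nothing ∷ nothing ∷ just (certificate 1827682444298601600 9782845203895465200 143005780707585 213310129965057) ∷ just (certificate 12929543340420259200 13557515351670188400 326900702711041 388959251530753) ∷ []) ∷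
  (just (certificate 9177556598082806400 16700934571760595600 151801877825793 213859860285441) ∷ nothing ∷ nothing ∷ just (certificate 7942989095192810880 10247319116501539680 285051078281473 285600880329729) ∷ just (certificate 12963320855034910080 13634077713548765280 179497425111041 424961814889473) ∷ nothing ∷ just (certificate 10513325274920449920 4446594283841284320 179222563981313 495330559069185) ∷ nothing ∷ nothing ∷ just (certificate 7933418800526194560 4505141972399582160 284844932434177 285605141744641) ∷ just (certificate 6737131312634962560 14404063714333725360 151733162543361 143491149662209) ∷ nothing ∷ nothing ∷ just (certificate 10513325274920449920 4446594283841284320 319960052336641 355692582341633) ∷ nothing ∷ just (certificate 12963320855034910080 13634077713548765280 285050541377537 285323838161921) ∷ just (certificate 6737131312634962560 14404063714333725360 433208139254017 144590661289985) ∷ nothing ∷ nothing ∷ just (certificate 7933418800526194560 4505141972399582160 152903537101057 425243118472193) ∷ nothing ∷ nothing ∷ nothing ∷ nothing ∷ just (certificate 9177556598082806400 16700934571760595600 424480761514241 214959371913217) ∷ just (certificate 7942989095192810880 10247319116501539680 179497962014977 425238857057281) ∷ nothing ∷ nothing ∷ []) ∷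
  (just (certificate 9168023832267768960 16691401805945558160 151801869502721 213859851962369) ∷ nothing ∷ nothing ∷ just (certificate 15379389389235043200 7851226268176759200 291716347268353 388405200489473) ∷ nothing ∷ just (certificate 1866282046960467840 3289151518971033840 317761029082113 352948098239489) ∷ nothing ∷ just (certificate 6766123675889712000 7918781293363738800 282851534769153 283129109613569) ∷ just (certificate 4287173261372081280 14376586918749205680 433208126769409 144590652966913) ∷ nothing ∷ nothing ∷ just (certificate 10479547760305799040 3221596493784054240 423382864825601 529692444920833) ∷ just (certificate 6766123675889712000 7918781293363738800 458773395213313 423866597968897) ∷ nothing ∷ just (certificate 1866282046960467840 3289151518971033840 458498517437441 493685586594817) ∷ nothing ∷ nothing ∷ just (certificate 10479547760305799040 3221596493784054240 291441469492481 388954956565505) ∷ just (certificate 4287173261372081280 14376586918749205680 151733150058753 143491141339137) ∷ nothing ∷ nothing ∷ nothing ∷ nothing ∷ nothing ∷ just (certificate 15379389389235043200 7851226268176759200 458842114690305 529142688844801) ∷ just (certificate 9168023832267768960 16691401805945558160 424480753191169 214959363590145) ∷ nothing ∷ nothing ∷ []) ∷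
  (just (certificate 9177556598082806400 16700934571760595600 152832669976833 495334836996097) ∷ nothing ∷ nothing ∷ just (certificate 15379389389235043200 7851226268176759200 293846651047169 390604223745025) ∷ just (certificate 9182341745416114560 17038709697884240160 152834268006657 459873456292865) ∷ nothing ∷ nothing ∷ just (certificate 16599602031958965120 8053891343800613520 293847183723777 390881232358401) ∷ just (certificate 16642949841240232320 16101946680951474720 144107431331841 459596447679489) ∷ nothing ∷ just (certificate 15417952051183002240 15561506479203975840 144105300625409 494780819769345) ∷ nothing ∷ nothing ∷ just (certificate 16642949841240232320 16101946680951474720 293641012709377 319958470951937) ∷ just (certificate 15417952051183002240 15561506479203975840 293638882002945 355142843041793) ∷ nothing ∷ nothing ∷ just (certificate 9182341745416114560 17038709697884240160 293571756361985 320235479565313) ∷ nothing ∷ just (certificate 16599602031958965120 8053891343800613520 188294067457281 530519209085953) ∷ nothing ∷ nothing ∷ just (certificate 9177556598082806400 16700934571760595600 293570158332161 355696860268545) ∷ just (certificate 15379389389235043200 7851226268176759200 188293534780673 530242200472577) ∷ nothing ∷ nothing ∷ nothing ∷ nothing ∷ []) ∷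
  (just (certificate 9168023832267768960 16691401805945558160 152832661653761 495334828673025) ∷ nothing ∷ nothing ∷ just (certificate 7942989095192810880 10247319116501539680 282852055025921 283401857074177) ∷ nothing ∷ just (certificate 16609172326625581440 14944503916081224240 291373269978369 317763742663681) ∷ just (certificate 12967993999920120960 15534029683619456160 293638869518337 355142834718721) ∷ nothing ∷ nothing ∷ just (certificate 7995906613280250240 16025384319072897840 282645896432641 282856395965441) ∷ nothing ∷ just (certificate 16623809833740850560 11472316906558769760 458842634946561 459046692127745) ∷ just (certificate 7995906613280250240 16025384319072897840 432179477810177 423593884320769) ∷ nothing ∷ nothing ∷ just (certificate 16623809833740850560 11472316906558769760 291716867524609 318309203772417) ∷ just (certificate 16609172326625581440 14944503916081224240 432110758333697 458501231019009) ∷ nothing ∷ just (certificate 12967993999920120960 15534029683619456160 144105288140801 494780811446273) ∷ nothing ∷ nothing ∷ nothing ∷ just (certificate 7942989095192810880 10247319116501539680 458773915470081 424139345429505) ∷ just (certificate 9168023832267768960 16691401805945558160 293570150009089 355696851945473) ∷ nothing ∷ nothing ∷ nothing ∷ nothing ∷ []) ∷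
  (nothing ∷ just (certificate 1818149678488003200 9774433939941020400 432108627659009 493685603371009) ∷ just (certificate 1827682444298601600 9782845203895465200 432108619335937 493685595047937) ∷ nothing ∷ just (certificate 10508503182846641280 10940287968765715680 291439850457089 353493567539201) ∷ nothing ∷ nothing ∷ just (certificate 6717991305135580800 9504222085404481200 282849924319489 283404004427777) ∷ nothing ∷ just (certificate 15398812043683620480 10661664850274731680 458840504240129 493956186179585) ∷ nothing ∷ just (certificate 10498970417036042880 10931876704811270880 423381254113281 494231064217601) ∷ just (certificate 10498970417036042880 10931876704811270880 291439858780161 353493575862273) ∷ nothing ∷ nothing ∷ just (certificate 15398812043683620480 10661664850274731680 291714736818177 353218697824257) ∷ nothing ∷ just (certificate 6717991305135580800 9504222085404481200 458771784763649 424141492783105) ∷ nothing ∷ just (certificate 10508503182846641280 10940287968765715680 423381245790209 494231055894529) ∷ just (certificate 1818149678488003200 9774433939941020400 291371139303681 352948115015681) ∷ just (certificate 1827682444298601600 9782845203895465200 291371130980609 352948106692609) ∷ nothing ∷ nothing ∷ nothing ∷ nothing ∷ nothing ∷ nothing ∷ []) ∷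
  (nothing ∷ just (certificate 12929543340420259200 13557515351670188400 424757237583105 250420786430977) ∷ just (certificate 7952558808025576320 9134771746792287120 152078903216385 214136885677057) ∷ nothing ∷ nothing ∷ just (certificate 9158416590583424640 16394694469952517840 285117662857473 285602994391041) ∷ just (certificate 6732346165301654400 8999661696355412400 152078370539777 178952530365441) ∷ nothing ∷ just (certificate 7976766605780868480 11395754544680192880 178467169864705 214136919491585) ∷ nothing ∷ just (certificate 10518110422253758080 15255266377395898080 179564550752257 495605453883393) ∷ nothing ∷ nothing ∷ just (certificate 10518110422253758080 15255266377395898080 293913760040961 355967477155841) ∷ just (certificate 7976766605780868480 11395754544680192880 433553867508737 215236431119361) ∷ nothing ∷ just (certificate 6732346165301654400 8999661696355412400 459941626317057 180052041993217) ∷ nothing ∷ just (certificate 9158416590583424640 16394694469952517840 188360639613185 425240971118593) ∷ nothing ∷ just (certificate 7952558808025576320 9134771746792287120 459942158993665 215236397304833) ∷ just (certificate 12929543340420259200 13557515351670188400 187262725983489 249321274803201) ∷ nothing ∷ nothing ∷ nothing ∷ nothing ∷ nothing ∷ nothing ∷ []) ∷ []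

certified-pairs : ∀ i j → let hᵢ = lookup bentNormalForms i ; hⱼ = lookup bentNormalForms j in
  hᵢ ⊕ hⱼ ∈ bentNormalForms → Maybe.Any (Certifies (basis hᵢ hⱼ) referenceBasis) (lookup (lookup certificates i) j)
certified-pairs = from-yes (all? λ i → all? λ j →
  let hᵢ = lookup bentNormalForms i ; hⱼ = lookup bentNormalForms j in
  (hᵢ ⊕ hⱼ ∈? bentNormalForms) →-dec Maybe.dec (certifies? (basis hᵢ hⱼ) referenceBasis) (lookup (lookup certificates i) j))

pair-equivalent : ∀ i j → let hᵢ = lookup bentNormalForms i ; hⱼ = lookup bentNormalForms j in
  hᵢ ⊕ hⱼ ∈ bentNormalForms → Equivalent (Span (basis hᵢ hⱼ)) (Span referenceBasis)
pair-equivalent i j p =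
  Certifies⇒Equivalent (basis (lookup bentNormalForms i) (lookup bentNormalForms j)) referenceBasis
    (proj₁ certified) (proj₂ certified)
  where certified = Maybe.satisfied (certified-pairs i j p)

normalForms-equivalent : ∀ {h₁ h₂} → h₁ ∈ bentNormalForms → h₂ ∈ bentNormalForms → h₁ ⊕ h₂ ∈ bentNormalForms →
                         Equivalent (Span (basis h₁ h₂)) (Span referenceBasis)
normalForms-equivalent p₁ p₂ p₁₂ =
  subst₂ (λ x y → Equivalent (Span (basis x y)) (Span referenceBasis)) (sym e₁) (sym e₂)
    (pair-equivalent (index p₁) (index p₂) (subst₂ (λ x y → x ⊕ y ∈ bentNormalForms) e₁ e₂ p₁₂))
  where
  e₁ = lookup-index p₁
  e₂ = lookup-index p₂

codeC-reference : ∀ f₁ f₂ → IsBentVectorial f₁ f₂ → Equivalent (codeC f₁ f₂) (Span referenceBasis)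
codeC-reference f₁ f₂ (bent₁ , bent₂ , bent₁₂) =
  Equivalent-respˡ {C = codeC f₁ f₂} {C′ = Span (basis (normalise t₁) (normalise t₂))} {D = Span referenceBasis}
    (SameCode-trans {C = codeC f₁ f₂} (codeC-basis f₁ f₂) (basis-normalise t₁ t₂))
    (normalForms-equivalent (normalise-∈ t₁ (IsBent⇒IsBentW f₁ bent₁)) (normalise-∈ t₂ (IsBent⇒IsBentW f₂ bent₂))
      (subst (_∈ bentNormalForms) (normalise-⊕ t₁ t₂) (normalise-∈ (t₁ ⊕ t₂) bent₁₂′)))
  where
  t₁ = truthTable f₁
  t₂ = truthTable f₂
  bent₁₂′ : IsBentW (t₁ ⊕ t₂)
  bent₁₂′ = subst IsBentW (map-xor f₁ f₂ elems) (IsBent⇒IsBentW (λ x → f₁ x xor f₂ x) bent₁₂)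

codeC-parameters : ∀ f₁ f₂ → IsBentVectorial f₁ f₂ → Is[ 16 , 7 , 6 ]Code (codeC f₁ f₂)
codeC-parameters f₁ f₂ (bent₁ , bent₂ , bent₁₂) =
  code-resp {C = codeC f₁ f₂} (codeC-basis f₁ f₂)
    (basis-code _ _ (IsBent⇒IsBentW f₁ bent₁) (IsBent⇒IsBentW f₂ bent₂)
      (subst IsBentW (map-xor f₁ f₂ elems) (IsBent⇒IsBentW (λ x → f₁ x xor f₂ x) bent₁₂)))

q₁ q₂ : BoolFun
q₁ (x₀ ∷ x₁ ∷ x₂ ∷ x₃ ∷ []) = (x₀ ∧ x₁) xor (x₂ ∧ x₃)
q₂ (x₀ ∷ x₁ ∷ x₂ ∷ x₃ ∷ []) = (x₀ ∧ x₂) xor ((x₁ ∧ x₃) xor (x₂ ∧ x₃))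

bent? : Decidable IsBent
bent? f = ∀-word? 4 (λ w → ∣ walsh f w ∣ ℕ.≟ 4)

q₁q₂-bentVectorial : IsBentVectorial q₁ q₂
q₁q₂-bentVectorial = from-yes (bent? q₁ ×-dec bent? q₂ ×-dec bent? (λ x → q₁ x xor q₂ x))

theorem7 : (∃[ f1 ] ∃[ f2 ] IsBentVectorial f1 f2) ×
    (∀ f1 f2 → IsBentVectorial f1 f2 → Is[ 16 , 7 , 6 ]Code (codeC f1 f2)) ×
    (∀ f1 f2 g1 g2 → IsBentVectorial f1 f2 → IsBentVectorial g1 g2 → Equivalent (codeC f1 f2) (codeC g1 g2))
theorem7 =
  (q₁ , q₂ , q₁q₂-bentVectorial) ,
  codeC-parameters ,
  λ f₁ f₂ g₁ g₂ bent-f bent-g →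
    Equivalent-trans {C = codeC f₁ f₂} {D = Span referenceBasis} {E = codeC g₁ g₂} (codeC-reference f₁ f₂ bent-f)
      (Equivalent-sym {C = codeC g₁ g₂} {D = Span referenceBasis} (codeC-reference g₁ g₂ bent-g))
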